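{- Let $b \ge 2$ be an integer and let $\gamma_{1,b,1} = b+3, b+1, b, \ldots, 2, b+2, 1 \in S_{b+3}$. Then for all $n \ge 1$, $$|S_n(132, 123, \gamma_{1,b,1})| = \left( \frac{1}{b-1} \right)^2 \left( \frac{b^2 - 3b}{2} + (1-b)n + g_b(n)\right),$$ where $$g_b(n) = \frac{b^2 - b + 2}{2} F_{b,n+1} + (b-1) F_{b,n} + \sum_{i=2}^{b-1} \left[ (1-b) \binom{i}{2} + \frac{b^2-b-2}{2} i - \frac{b^2-3b}{2} \right] F_{b,n-i+1}.$$ Moreover, $$\sum_{n=0}^\infty |S_n(132, 123, \gamma_{1,b,1})| x^n = \frac{1 - 2x + x^2 + x^{b+1}}{(1-x)^2 (1- x - \cdots - x^b)}.$$
   Context: $S_n$ is the set of permutations of $\{1,\dots,n\}$ in one-line notation; $\pi$ avoids $\sigma\in S_k$ if no subsequence of $\pi$ of length $k$ has the same relative order as $\sigma$; $S_n(R)$ is the set of $\pi\in S_n$ avoiding every element of $R$, and $S_0(R)$ contains only the empty permutation. For $k\ge1$, $F_{k,n}=0$ for $n\le 0$, $F_{k,1}=1$, and $F_{k,n}=\sum_{i=1}^k F_{k,n-i}$ for $n \ge 2$. -}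

module Defs where

open import Data.Nat as ℕ using (ℕ; zero; suc; _<_)
open import Data.Integer as ℤ using (ℤ; +_; -[1+_])
open import Data.Rational as ℚ using (ℚ; 0ℚ)
open import Data.List using (List; []; _∷_; _++_; map; length; lookup; upTo; downFrom; take; foldr; applyUpTo; replicate)
open import Data.Nat.ListAction using (sum)
open import Data.List.Relation.Binary.Sublist.Propositional using (_⊆_)
open import Data.List.Relation.Binary.Permutation.Propositional using (_↭_)
open import Data.List.Relation.Unary.All using (All)
open import Data.List.Relation.Unary.Unique.Propositional using (Unique)
open import Data.List.Membership.Propositional using (_∈_)
open import Data.Fin using (Fin; cast)
open import Data.Maybe using (Maybe; just; nothing)
open import Data.Product using (Σ; _×_; ∃)
open import Function.Bundles using (_⇔_)
open import Relation.Binary.PropositionalEquality using (_≡_)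
open import Relation.Nullary using (¬_)

-- one-line notation: a permutation of {1,…,n} is a list that is a
-- rearrangement of [1, 2, …, n]
IsPerm : ℕ → List ℕ → Set
IsPerm n π = π ↭ applyUpTo suc n

OrderIso : List ℕ → List ℕ → Set
OrderIso xs ys =
  Σ (length xs ≡ length ys) λ eq →
    ∀ (i j : Fin (length xs)) →
      (lookup xs i < lookup xs j) ⇔ (lookup ys (cast eq i) < lookup ys (cast eq j))

Contains : List ℕ → List ℕ → Set
Contains π σ = ∃ λ xs → xs ⊆ π × OrderIso xs σ

Avoids : List ℕ → List ℕ → Set
Avoids π σ = ¬ Contains π σ

InS : ℕ → List (List ℕ) → List ℕ → Set
InS n R π = IsPerm n π × All (Avoids π) R

HasCard : (List ℕ → Set) → ℕ → Set
HasCard P m =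
  Σ (List (List ℕ)) λ L → Unique L × (∀ x → (x ∈ L) ⇔ P x) × length L ≡ m

p132 : List ℕ
p132 = 1 ∷ 3 ∷ 2 ∷ []

p123 : List ℕ
p123 = 1 ∷ 2 ∷ 3 ∷ []

gamma : ℕ → List ℕ
gamma b = (3 ℕ.+ b) ∷ (map (2 ℕ.+_) (downFrom b) ++ ((2 ℕ.+ b) ∷ 1 ∷ []))

-- Fs k n = [F_{k,n}, F_{k,n-1}, …, F_{k,0}]
Fs : ℕ → ℕ → List ℕ
Fs k zero = 0 ∷ []
Fs k (suc zero) = 1 ∷ 0 ∷ []
Fs k (suc (suc m)) = sum (take k (Fs k (suc m))) ∷ Fs k (suc m)

Fℕ : ℕ → ℕ → ℕ
Fℕ k n with Fs k n
... | [] = 0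
... | x ∷ _ = x

-- F_{k,n} for integer n (zero for n ≤ 0)
F : ℕ → ℤ → ℕ
F k (+ n) = Fℕ k n
F k -[1+ n ] = 0

ℕ→ℚ : ℕ → ℚ
ℕ→ℚ n = + n ℚ./ 1

ℤ→ℚ : ℤ → ℚ
ℤ→ℚ z = z ℚ./ 1

Σℚ : List ℕ → (ℕ → ℚ) → ℚ
Σℚ is f = foldr (λ i acc → f i ℚ.+ acc) 0ℚ is

coeff : List ℤ → ℕ → ℤ
coeff [] n = + 0
coeff (c ∷ cs) zero = c
coeff (c ∷ cs) (suc n) = coeff cs n

Σℤ≤ : ℕ → (ℕ → ℤ) → ℤ
Σℤ≤ zero f = f 0
Σℤ≤ (suc n) f = Σℤ≤ n f ℤ.+ f (suc n)

polyMul : List ℤ → List ℤ → List ℤ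
polyMul p q = applyUpTo (λ n → Σℤ≤ n (λ j → coeff p j ℤ.* coeff q (n ℕ.∸ j))) (length p ℕ.+ length q)

polyAdd : List ℤ → List ℤ → List ℤ
polyAdd [] q = q
polyAdd p [] = p
polyAdd (a ∷ p) (c ∷ q) = (a ℤ.+ c) ∷ polyAdd p q

monomial : ℕ → List ℤ
monomial k = replicate k (+ 0) ++ (+ 1 ∷ [])

numPoly : ℕ → List ℤ
numPoly b = polyAdd (+ 1 ∷ ℤ.- (+ 2) ∷ + 1 ∷ []) (monomial (suc b))

denPoly : ℕ → List ℤ
denPoly b = polyMul (polyMul oneMinusX oneMinusX) (+ 1 ∷ replicate b (ℤ.- (+ 1)))
  where
  oneMinusX : List ℤ
  oneMinusX = + 1 ∷ ℤ.- (+ 1) ∷ []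

-- the power series Σ a_n x^n equals N(x)/D(x) (D(0) = 1), i.e. D(x)·Σ a_n x^n = N(x)
SeriesEq : (ℕ → ℕ) → List ℤ → List ℤ → Set
SeriesEq a N D = ∀ n → Σℤ≤ n (λ j → coeff D j ℤ.* + a (n ℕ.∸ j)) ≡ coeff N n

module Submission where

-- A permutation avoids 132 and 123 iff it splits into blocks occupying decreasing ranges of
-- values, each block being a decreasing run followed by its maximum; it is then coded by the
-- run lengths. Such a permutation contains γ_{1,b,1} iff some block other than the first and
-- the last has a run of length at least b. The middle runs form a composition into parts at
-- most b, counted by the b-generalized Fibonacci numbers, so the number a n of codes of weight n
-- satisfies a 0 = 1 and a (n + 1) = a n + F_{b,0} + ⋯ + F_{b,n}.
-- Closed form: 2 (b - 1)² times the right-hand side has the same second difference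
-- 2 (b - 1)² F_{b,n+1} and the same two initial values as 2 (b - 1)² a n; the weights of g_b have
-- constant second difference and vanish at i = b, so summation by parts and the Fibonacci
-- recurrence collapse the second difference of g_b.
-- Generating function: a and the partial sums of F satisfy jump relations valid on all of ℤ,
-- under which the convolution of a with the denominator telescopes to the numerator.

open import Data.Nat as ℕ using (ℕ; zero; suc; _≤_; _<_; _>_; _∸_; z≤n; s≤s)
import Data.Nat.Properties as ℕ
open import Data.Nat.Properties using (m<n⇒0<n∸m)
import Data.Nat.Combinatorics as Combinatorics
open import Data.Nat.Induction using (<-rec)
open import Data.Nat.ListAction using (sum)
open import Data.Integer as ℤ using (ℤ; +_; -[1+_])
import Data.Integer.Properties as ℤ
open import Data.Integer.Tactic.RingSolver using (solve-∀)
open import Data.Rational as ℚ using (ℚ; 1ℚ; _/_)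
import Data.Rational.Properties as ℚ
open import Data.Rational.Properties using (toℚᵘ-injective; toℚᵘ-fromℚᵘ; toℚᵘ-homo-+; toℚᵘ-homo-*; toℚᵘ-homo‿-)
open import Data.Rational.Solver renaming (module +-*-Solver to ℚ-Solver)
open import Data.Rational.Unnormalised as ℚᵘ using (mkℚᵘ; *≡*)
import Data.Rational.Unnormalised.Properties as ℚᵘ
open import Data.Fin as Fin using (toℕ)
import Data.Fin.Properties as Fin
open import Data.List using (List; []; _∷_; _++_; [_]; map; length; lookup; take; replicate; concatMap; upTo; applyUpTo; applyDownFrom; downFrom; initLast; _∷ʳ′_)
import Data.List.Properties as List
open import Data.List.Properties using (take-[])
open import Data.List.Membership.Propositional using (_∈_; _∉_)
import Data.List.Membership.Propositional.Properties as ∈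
open import Data.List.Relation.Unary.Any using (here; there)
open import Data.List.Relation.Unary.All as All using (All; []; _∷_)
import Data.List.Relation.Unary.All.Properties as All
open import Data.List.Relation.Unary.AllPairs using (AllPairs; []; _∷_)
import Data.List.Relation.Unary.AllPairs.Properties as AllPairs
open import Data.List.Relation.Unary.Unique.Propositional using (Unique)
import Data.List.Relation.Unary.Unique.Propositional.Properties as Unique
open import Data.List.Relation.Binary.Pointwise as Pointwise using (Pointwise; []; _∷_)
open import Data.List.Relation.Binary.Sublist.Propositional as Sublist using (_⊆_; []; _∷_; _∷ʳ_; ⊆-refl; ⊆-trans; minimum; to∈; from∈)
open import Data.List.Relation.Binary.Sublist.Propositional.Properties using (length-mono-≤; ++⁺ˡ; ++⁺; ∷ˡ⁻; All-resp-⊆)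
open import Data.List.Relation.Binary.Permutation.Propositional using (_↭_; ↭-refl; ↭-sym; ↭-trans; ↭-reflexive; ↭⇒↭ₛ)
import Data.List.Relation.Binary.Permutation.Propositional.Properties as ↭
import Data.List.Relation.Binary.Permutation.Setoid.Properties as PermutationSetoid
open import Data.Product using (Σ; Σ-syntax; ∃₂; _×_; _,_; proj₁; proj₂)
open import Data.Sum using (_⊎_; inj₁; inj₂)
open import Data.Empty using (⊥; ⊥-elim)
open import Data.Unit using (⊤; tt)
open import Function using (_∘_)
open import Function.Bundles using (_⇔_; mk⇔; Equivalence)
open import Relation.Nullary using (¬_; yes; no)
open import Relation.Binary using (tri<; tri≈; tri>)
open import Relation.Binary.PropositionalEquality hiding ([_])
open import Defs

module IntegerSums where
  open import Data.Integer using (_+_; _-_; _*_)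

  Σ< : ℕ → (ℕ → ℤ) → ℤ
  Σ< zero f = + 0
  Σ< (suc n) f = f 0 + Σ< n (f ∘ suc)

  Σ<-cong : ∀ n {f g : ℕ → ℤ} → (∀ i → f i ≡ g i) → Σ< n f ≡ Σ< n g
  Σ<-cong zero eq = refl
  Σ<-cong (suc n) eq = cong₂ _+_ (eq 0) (Σ<-cong n (eq ∘ suc))

  Σ<-suc : ∀ n f → Σ< (suc n) f ≡ Σ< n f + f n
  Σ<-suc zero f = trans (ℤ.+-identityʳ (f 0)) (sym (ℤ.+-identityˡ (f 0)))
  Σ<-suc (suc n) f = trans (cong (_+_ (f 0)) (Σ<-suc n (f ∘ suc))) (sym (ℤ.+-assoc (f 0) _ _))

  Σ<-zero : ∀ n {f} → (∀ i → f i ≡ + 0) → Σ< n f ≡ + 0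
  Σ<-zero zero eq = refl
  Σ<-zero (suc n) eq = cong₂ _+_ (eq 0) (Σ<-zero n (eq ∘ suc))

  Σ<-summation-by-parts :
    ∀ (q h : ℕ → ℤ) T → (∀ i → q i - + 2 * q (1 ℕ.+ i) + q (2 ℕ.+ i) ≡ T) → ∀ L →
    Σ< (2 ℕ.+ L) (λ i → q i * h i) - + 2 * Σ< (2 ℕ.+ L) (λ i → q i * h (1 ℕ.+ i))
      + Σ< (2 ℕ.+ L) (λ i → q i * h (2 ℕ.+ i))
    ≡ q 0 * h 0 + (q 1 - + 2 * q 0) * h 1 + T * Σ< L (λ j → h (2 ℕ.+ j))
      + (q L - + 2 * q (1 ℕ.+ L)) * h (2 ℕ.+ L) + q (1 ℕ.+ L) * h (3 ℕ.+ L)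
  Σ<-summation-by-parts q h T Δ²q zero = base (q 0) (q 1) (h 0) (h 1) (h 2) (h 3) T
    where
    base : ∀ q₀ q₁ h₀ h₁ h₂ h₃ T →
      (q₀ * h₀ + (q₁ * h₁ + + 0)) - + 2 * (q₀ * h₁ + (q₁ * h₂ + + 0)) + (q₀ * h₂ + (q₁ * h₃ + + 0))
      ≡ q₀ * h₀ + (q₁ - + 2 * q₀) * h₁ + T * + 0 + (q₀ - + 2 * q₁) * h₂ + q₁ * h₃
    base = solve-∀
  Σ<-summation-by-parts q h T Δ²q (suc L) = begin
    Σ< (3 ℕ.+ L) (λ i → q i * h i) - + 2 * Σ< (3 ℕ.+ L) (λ i → q i * h (1 ℕ.+ i))
      + Σ< (3 ℕ.+ L) (λ i → q i * h (2 ℕ.+ i))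
      ≡⟨ cong₂ _+_ (cong₂ (λ u v → u - + 2 * v) (Σ<-suc (2 ℕ.+ L) (λ i → q i * h i)) (Σ<-suc (2 ℕ.+ L) (λ i → q i * h (1 ℕ.+ i))))
          (Σ<-suc (2 ℕ.+ L) (λ i → q i * h (2 ℕ.+ i))) ⟩
    (S₀ + q₂ * x) - + 2 * (S₁ + q₂ * y) + (S₂ + q₂ * z)
      ≡⟨ regroup S₀ S₁ S₂ q₂ x y z ⟩
    (S₀ - + 2 * S₁ + S₂) + q₂ * (x - + 2 * y + z)
      ≡⟨ cong (_+ q₂ * (x - + 2 * y + z)) (Σ<-summation-by-parts q h T Δ²q L) ⟩
    A + T * s + (q L - + 2 * q₁) * x + q₁ * y + q₂ * (x - + 2 * y + z)
      ≡⟨ cong (λ u → A + T * s + u * x + q₁ * y + q₂ * (x - + 2 * y + z)) qL-2q₁ ⟩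
    A + T * s + (T - q₂) * x + q₁ * y + q₂ * (x - + 2 * y + z)
      ≡⟨ absorb A T s q₁ q₂ x y z ⟩
    A + T * (s + x) + (q₁ - + 2 * q₂) * y + q₂ * z
      ≡⟨ cong (λ u → A + T * u + (q₁ - + 2 * q₂) * y + q₂ * z) (sym (Σ<-suc L (λ j → h (2 ℕ.+ j)))) ⟩
    A + T * Σ< (1 ℕ.+ L) (λ j → h (2 ℕ.+ j)) + (q₁ - + 2 * q₂) * y + q₂ * z ∎
    where
    open ≡-Reasoning
    S₀ = Σ< (2 ℕ.+ L) (λ i → q i * h i)
    S₁ = Σ< (2 ℕ.+ L) (λ i → q i * h (1 ℕ.+ i))
    S₂ = Σ< (2 ℕ.+ L) (λ i → q i * h (2 ℕ.+ i))
    A = q 0 * h 0 + (q 1 - + 2 * q 0) * h 1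
    s = Σ< L (λ j → h (2 ℕ.+ j))
    q₁ = q (1 ℕ.+ L)
    q₂ = q (2 ℕ.+ L)
    x = h (2 ℕ.+ L)
    y = h (3 ℕ.+ L)
    z = h (4 ℕ.+ L)
    regroup : ∀ S₀ S₁ S₂ q₂ x y z →
      (S₀ + q₂ * x) - + 2 * (S₁ + q₂ * y) + (S₂ + q₂ * z) ≡ (S₀ - + 2 * S₁ + S₂) + q₂ * (x - + 2 * y + z)
    regroup = solve-∀
    absorb : ∀ A T s q₁ q₂ x y z →
      A + T * s + (T - q₂) * x + q₁ * y + q₂ * (x - + 2 * y + z) ≡ A + T * (s + x) + (q₁ - + 2 * q₂) * y + q₂ * z
    absorb = solve-∀
    qL-2q₁ : q L - + 2 * q₁ ≡ T - q₂
    qL-2q₁ = trans (cancel (q L - + 2 * q₁) q₂) (cong (_- q₂) (Δ²q L))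
      where
      cancel : ∀ u v → u ≡ (u + v) - v
      cancel = solve-∀

  second-difference-unique : ∀ (u v w : ℕ → ℤ) → u 0 ≡ v 0 → u 1 ≡ v 1 →
    (∀ n → u (2 ℕ.+ n) ≡ + 2 * u (1 ℕ.+ n) - u n + w n) →
    (∀ n → v (2 ℕ.+ n) ≡ + 2 * v (1 ℕ.+ n) - v n + w n) →
    ∀ n → u n ≡ v n
  second-difference-unique u v w u₀ u₁ Δ²u Δ²v n = proj₁ (consecutive n)
    where
    consecutive : ∀ n → u n ≡ v n × u (suc n) ≡ v (suc n)
    consecutive zero = u₀ , u₁
    consecutive (suc n) with consecutive n
    ... | uₙ , uₙ₊₁ = uₙ₊₁ , trans (Δ²u n) (trans (cong₂ (λ x y → + 2 * x - y + w n) uₙ₊₁ uₙ) (sym (Δ²v n)))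

  sub-cancelˡ : ∀ a x y → (a + x) - (a + y) ≡ x - y
  sub-cancelˡ = solve-∀

module Fibonacci where
  open import Data.Integer using (_+_; _-_)
  open IntegerSums

  Fℤ : ℕ → ℤ → ℤ
  Fℤ k z = + F k z

  private
    Fs-suc : ∀ k m → Fs k (suc m) ≡ Fℕ k (suc m) ∷ Fs k m
    Fs-suc k zero = refl
    Fs-suc k (suc m) = refl

    shift : ∀ x y → x - y ≡ (+ 1 + x) - (+ 1 + y)
    shift = solve-∀

    sum-take-Fs : ∀ k i n → + sum (take i (Fs k n)) ≡ Σ< i (λ j → Fℤ k (+ n - + j))
    sum-take-Fs k zero n = refl
    sum-take-Fs k (suc zero) zero = refl
    sum-take-Fs k (suc (suc i)) zero = sym (Σ<-zero (2 ℕ.+ i) {λ j → Fℤ k (+ 0 - + j)} λ { zero → refl ; (suc j) → refl })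
    sum-take-Fs k (suc i) (suc n) rewrite Fs-suc k n =
      trans (ℤ.pos-+ (Fℕ k (suc n)) _)
            (cong₂ _+_ (cong (Fℤ k) (sym (ℤ.+-identityʳ (+ suc n))))
                       (trans (sum-take-Fs k i n) (Σ<-cong i λ j → cong (Fℤ k) (shift (+ n) (+ j)))))

  F-recurrence : ∀ k m → Fℤ k (+ suc (suc m)) ≡ Σ< k (λ i → Fℤ k (+ suc m - + i))
  F-recurrence k m = sum-take-Fs k k (suc m)

module Weights where
  open import Data.Integer using (_+_; _-_; _*_; -_)
  open Combinatorics using (_C_; nC1≡n; nCk+nC[k+1]≡[n+1]C[k+1])

  -- coef (+ b) (+ i) is twice the coefficient of F_{b,n-i+1} in g_b(n). As solve-∀ does not unfold
  -- definitions, the identities below are stated on the unfolded polynomial.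
  coef : ℤ → ℤ → ℤ
  coef β x = (+ 1 - β) * (x * (x - + 1)) + (β * β - β - + 2) * x - (β * β - + 3 * β)

  coef-Δ² : ∀ β x → coef β x - + 2 * coef β (+ 1 + x) + coef β (+ 2 + x) ≡ + 2 * (+ 1 - β)
  coef-Δ² = identity
    where
    identity : ∀ β x →
      ((+ 1 - β) * (x * (x - + 1)) + (β * β - β - + 2) * x - (β * β - + 3 * β))
      - + 2 * ((+ 1 - β) * ((+ 1 + x) * ((+ 1 + x) - + 1)) + (β * β - β - + 2) * (+ 1 + x) - (β * β - + 3 * β))
      + ((+ 1 - β) * ((+ 2 + x) * ((+ 2 + x) - + 1)) + (β * β - β - + 2) * (+ 2 + x) - (β * β - + 3 * β))
      ≡ + 2 * (+ 1 - β)
    identity = solve-∀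

  coef-root : ∀ β → coef β β ≡ + 0
  coef-root = identity
    where
    identity : ∀ β → (+ 1 - β) * (β * (β - + 1)) + (β * β - β - + 2) * β - (β * β - + 3 * β) ≡ + 0
    identity = solve-∀

  coef-0 : ∀ β → coef β (+ 0) ≡ - (β * β - + 3 * β)
  coef-0 = identity
    where
    identity : ∀ β → (+ 1 - β) * (+ 0 * (+ 0 - + 1)) + (β * β - β - + 2) * + 0 - (β * β - + 3 * β) ≡ - (β * β - + 3 * β)
    identity = solve-∀

  coef-1 : ∀ β → coef β (+ 1) ≡ + 2 * (β - + 1)
  coef-1 = identity
    where
    identity : ∀ β → (+ 1 - β) * (+ 1 * (+ 1 - + 1)) + (β * β - β - + 2) * + 1 - (β * β - + 3 * β) ≡ + 2 * (β - + 1)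
    identity = solve-∀

  coef-pred-root : ∀ x → coef (+ 1 + x) x ≡ x * x - x + + 2
  coef-pred-root = identity
    where
    identity : ∀ x → let β = + 1 + x in
      (+ 1 - β) * (x * (x - + 1)) + (β * β - β - + 2) * x - (β * β - + 3 * β) ≡ x * x - x + + 2
    identity = solve-∀

  two-C2 : ∀ i → + 2 * + (i C 2) ≡ + i * (+ i - + 1)
  two-C2 zero = refl
  two-C2 (suc i) = begin
    + 2 * + (suc i C 2)                ≡⟨ cong (λ k → + 2 * + k) (sym (nCk+nC[k+1]≡[n+1]C[k+1] i 1)) ⟩
    + 2 * + (i C 1 ℕ.+ i C 2)          ≡⟨ cong (λ k → + 2 * + (k ℕ.+ i C 2)) (nC1≡n i) ⟩
    + 2 * + (i ℕ.+ i C 2)              ≡⟨ cong (_*_ (+ 2)) (ℤ.pos-+ i (i C 2)) ⟩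
    + 2 * (+ i + + (i C 2))            ≡⟨ ℤ.*-distribˡ-+ (+ 2) (+ i) (+ (i C 2)) ⟩
    + 2 * + i + + 2 * + (i C 2)        ≡⟨ cong (_+_ (+ 2 * + i)) (two-C2 i) ⟩
    + 2 * + i + + i * (+ i - + 1)      ≡⟨ identity (+ i) ⟩
    (+ 1 + + i) * ((+ 1 + + i) - + 1) ∎
    where
    open ≡-Reasoning
    identity : ∀ x → + 2 * x + x * (x - + 1) ≡ (+ 1 + x) * ((+ 1 + x) - + 1)
    identity = solve-∀

  coef-binomial : ∀ b i →
    + 2 * ((+ 1 - + b) * + (i C 2)) + (+ (b ℕ.* b) - + b - + 2) * + i - (+ (b ℕ.* b) - + (3 ℕ.* b))
    ≡ coef (+ b) (+ i)
  coef-binomial b i rewrite ℤ.pos-* b b | ℤ.pos-* 3 b = begin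
    + 2 * ((+ 1 - + b) * + (i C 2)) + (+ b * + b - + b - + 2) * + i - (+ b * + b - + 3 * + b)
      ≡⟨ identity (+ b) (+ i) (+ (i C 2)) ⟩
    (+ 1 - + b) * (+ 2 * + (i C 2)) + (+ b * + b - + b - + 2) * + i - (+ b * + b - + 3 * + b)
      ≡⟨ cong (λ u → (+ 1 - + b) * u + (+ b * + b - + b - + 2) * + i - (+ b * + b - + 3 * + b)) (two-C2 i) ⟩
    coef (+ b) (+ i) ∎
    where
    open ≡-Reasoning
    identity : ∀ β x C → + 2 * ((+ 1 - β) * C) + (β * β - β - + 2) * x - (β * β - + 3 * β)
                       ≡ (+ 1 - β) * (+ 2 * C) + (β * β - β - + 2) * x - (β * β - + 3 * β)
    identity = solve-∀

module ClosedFormℤ (c : ℕ) where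
  open import Data.Integer using (_+_; _-_; _*_; -_)
  open IntegerSums
  open Fibonacci
  open Weights

  b : ℕ
  b = 2 ℕ.+ c

  β : ℤ
  β = + b

  weight : ℕ → ℤ
  weight i = coef β (+ i)

  κ : ℤ
  κ = + 2 * (β - + 1) * (β - + 1)

  window-second-difference : ∀ (h : ℕ → ℤ) →
    h 0 ≡ Σ< b (λ i → h (1 ℕ.+ i)) → h 1 ≡ Σ< b (λ i → h (2 ℕ.+ i)) →
    κ * (h 0 - + 2 * h 1 + h 2)
      + (Σ< b (λ i → weight i * h i) - + 2 * Σ< b (λ i → weight i * h (1 ℕ.+ i))
         + Σ< b (λ i → weight i * h (2 ℕ.+ i)))
    ≡ κ * h 2
  window-second-difference h rec₀ rec₁ = begin
    κ * (h 0 - + 2 * h 1 + h 2) + (S₀ - + 2 * S₁ + S₂)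
      ≡⟨ cong (_+_ (κ * (h 0 - + 2 * h 1 + h 2))) (Σ<-summation-by-parts weight h T (λ i → coef-Δ² β (+ i)) c) ⟩
    shape (h 0) (h 1) (weight c - + 2 * weight (1 ℕ.+ c)) (weight 0) (weight 1) (weight (1 ℕ.+ c))
      ≡⟨ shape-cong h₀≡ h₁≡ last-weights (coef-0 β) (coef-1 β) (coef-pred-root (+ suc c)) ⟩
    shape (s + g₂ + g₃ + (s + g₂)) (s + g₂ + g₃) T (- (β * β - + 3 * β)) (+ 2 * (β - + 1)) (+ suc c * + suc c - + suc c + + 2)
      ≡⟨ identity (+ suc c) s g₂ g₃ (h 2) ⟩
    κ * h 2 ∎
    where
    open ≡-Reasoning
    T = + 2 * (+ 1 - β)
    S₀ = Σ< b (λ i → weight i * h i)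
    S₁ = Σ< b (λ i → weight i * h (1 ℕ.+ i))
    S₂ = Σ< b (λ i → weight i * h (2 ℕ.+ i))
    s = Σ< c (λ j → h (2 ℕ.+ j))
    g₂ = h (2 ℕ.+ c)
    g₃ = h (3 ℕ.+ c)
    last-weights : weight c - + 2 * weight (1 ℕ.+ c) ≡ T
    last-weights = begin
      weight c - + 2 * weight (1 ℕ.+ c)                         ≡⟨ cancel (weight c - + 2 * weight (1 ℕ.+ c)) (weight b) ⟩
      weight c - + 2 * weight (1 ℕ.+ c) + weight b - weight b   ≡⟨ cong₂ _-_ (coef-Δ² β (+ c)) (coef-root β) ⟩
      T - + 0                                                   ≡⟨ ℤ.+-identityʳ T ⟩
      T ∎
      where
      cancel : ∀ u v → u ≡ u + v - v
      cancel = solve-∀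
    h₁≡ : h 1 ≡ s + g₂ + g₃
    h₁≡ = trans rec₁ (trans (Σ<-suc (1 ℕ.+ c) (λ j → h (2 ℕ.+ j))) (cong (_+ g₃) (Σ<-suc c (λ j → h (2 ℕ.+ j)))))
    h₀≡ : h 0 ≡ (s + g₂ + g₃) + (s + g₂)
    h₀≡ = trans rec₀ (cong₂ _+_ h₁≡ (Σ<-suc c (λ j → h (2 ℕ.+ j))))
    shape : ℤ → ℤ → ℤ → ℤ → ℤ → ℤ → ℤ
    shape h₀ h₁ t w₀ w₁ w₃ = κ * (h₀ - + 2 * h₁ + h 2) + (w₀ * h₀ + (w₁ - + 2 * w₀) * h₁ + T * s + t * g₂ + w₃ * g₃)
    shape-cong : ∀ {h₀ h₀′ h₁ h₁′ t t′ w₀ w₀′ w₁ w₁′ w₃ w₃′} → h₀ ≡ h₀′ → h₁ ≡ h₁′ → t ≡ t′ → w₀ ≡ w₀′ → w₁ ≡ w₁′ → w₃ ≡ w₃′ →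
      shape h₀ h₁ t w₀ w₁ w₃ ≡ shape h₀′ h₁′ t′ w₀′ w₁′ w₃′
    shape-cong refl refl refl refl refl refl = refl
    identity : ∀ x s g₂ g₃ h₂ → let β = + 1 + x ; T = + 2 * (+ 1 - β) in
      + 2 * (β - + 1) * (β - + 1) * ((s + g₂ + g₃) + (s + g₂) - + 2 * (s + g₂ + g₃) + h₂)
        + (- (β * β - + 3 * β) * ((s + g₂ + g₃) + (s + g₂)) + (+ 2 * (β - + 1) - + 2 * - (β * β - + 3 * β)) * (s + g₂ + g₃)
           + T * s + T * g₂ + (x * x - x + + 2) * g₃)
      ≡ + 2 * (β - + 1) * (β - + 1) * h₂
    identity = solve-∀

  f : ℤ → ℤ
  f = Fℤ b

  -- G (n + 1) = 2 g_b(n)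
  G : ℤ → ℤ
  G m = κ * f m + Σ< b (λ i → weight i * f (m - + i))

  G-shifted : ∀ a x → G x ≡ κ * f ((a + x) - (a + + 0)) + Σ< b (λ i → weight i * f ((a + x) - (a + + i)))
  G-shifted a x = cong₂ (λ u v → κ * f u + v)
    (sym (trans (sub-cancelˡ a x (+ 0)) (ℤ.+-identityʳ x)))
    (Σ<-cong b (λ i → cong (λ u → weight i * f u) (sym (sub-cancelˡ a x (+ i)))))

  G-second-difference : ∀ m → G (+ (3 ℕ.+ m)) - + 2 * G (+ (2 ℕ.+ m)) + G (+ (1 ℕ.+ m)) ≡ κ * f (+ (1 ℕ.+ m))
  G-second-difference m = begin
    G (+ (3 ℕ.+ m)) - + 2 * G (+ (2 ℕ.+ m)) + G (+ (1 ℕ.+ m))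
      ≡⟨ cong₂ _+_ (cong₂ (λ u v → u - + 2 * v) (G-shifted (+ 0) (+ (3 ℕ.+ m))) (G-shifted (+ 1) (+ (2 ℕ.+ m)))) (G-shifted (+ 2) (+ (1 ℕ.+ m))) ⟩
    (κ * h 0 + S 0) - + 2 * (κ * h 1 + S 1) + (κ * h 2 + S 2)
      ≡⟨ regroup κ (h 0) (h 1) (h 2) (S 0) (S 1) (S 2) ⟩
    κ * (h 0 - + 2 * h 1 + h 2) + (S 0 - + 2 * S 1 + S 2)
      ≡⟨ window-second-difference h rec₀ rec₁ ⟩
    κ * h 2
      ≡⟨ cong (λ u → κ * f u) (trans (sub-cancelˡ (+ 2) (+ (1 ℕ.+ m)) (+ 0)) (ℤ.+-identityʳ (+ (1 ℕ.+ m)))) ⟩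
    κ * f (+ (1 ℕ.+ m)) ∎
    where
    open ≡-Reasoning
    M = + (3 ℕ.+ m)
    h : ℕ → ℤ
    h i = f (M - + i)
    S : ℕ → ℤ
    S k = Σ< b (λ i → weight i * h (k ℕ.+ i))
    regroup : ∀ κ h₀ h₁ h₂ S₀ S₁ S₂ →
      (κ * h₀ + S₀) - + 2 * (κ * h₁ + S₁) + (κ * h₂ + S₂) ≡ κ * (h₀ - + 2 * h₁ + h₂) + (S₀ - + 2 * S₁ + S₂)
    regroup = solve-∀
    rec₀ : h 0 ≡ Σ< b (λ i → h (1 ℕ.+ i))
    rec₀ = trans (cong f (ℤ.+-identityʳ M))
      (trans (F-recurrence b (suc m)) (Σ<-cong b (λ i → cong f (sym (sub-cancelˡ (+ 1) (+ (2 ℕ.+ m)) (+ i))))))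
    rec₁ : h 1 ≡ Σ< b (λ i → h (2 ℕ.+ i))
    rec₁ = trans (cong f (trans (sub-cancelˡ (+ 1) (+ (2 ℕ.+ m)) (+ 0)) (ℤ.+-identityʳ (+ (2 ℕ.+ m)))))
      (trans (F-recurrence b m) (Σ<-cong b (λ i → cong f (sym (sub-cancelˡ (+ 2) (+ (1 ℕ.+ m)) (+ i))))))

  ΣF : ℕ → ℕ
  ΣF zero = Fℕ b 0
  ΣF (suc n) = ΣF n ℕ.+ Fℕ b (suc n)

  -- 2 (b - 1)² times the right-hand side of the closed formula
  Z : ℕ → ℤ
  Z n = (β * β - + 3 * β) + + 2 * (+ 1 - β) * + n + G (+ suc n)

  Z-second-difference : ∀ n → Z (2 ℕ.+ n) ≡ + 2 * Z (1 ℕ.+ n) - Z n + κ * f (+ suc n)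
  Z-second-difference n = begin
    Z (2 ℕ.+ n)
      ≡⟨ regroup (β * β - + 3 * β) (+ 2 * (+ 1 - β)) (+ n) (G (+ (3 ℕ.+ n))) (G (+ (2 ℕ.+ n))) (G (+ (1 ℕ.+ n))) ⟩
    + 2 * Z (1 ℕ.+ n) - Z n + (G (+ (3 ℕ.+ n)) - + 2 * G (+ (2 ℕ.+ n)) + G (+ (1 ℕ.+ n)))
      ≡⟨ cong (_+_ (+ 2 * Z (1 ℕ.+ n) - Z n)) (G-second-difference n) ⟩
    + 2 * Z (1 ℕ.+ n) - Z n + κ * f (+ suc n) ∎
    where
    open ≡-Reasoning
    regroup : ∀ K T x y₃ y₂ y₁ →
      K + T * (+ 2 + x) + y₃ ≡ + 2 * (K + T * (+ 1 + x) + y₂) - (K + T * x + y₁) + (y₃ - + 2 * y₂ + y₁)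
    regroup = solve-∀

  Z-0 : Z 0 ≡ κ
  Z-0 = begin
    Z 0
      ≡⟨ cong (λ s → K + T * + 0 + (κ * + 1 + (weight 0 * + 1 + (weight 1 * + 0 + s))))
              (Σ<-zero c (λ j → ℤ.*-zeroʳ (weight (2 ℕ.+ j)))) ⟩
    K + T * + 0 + (κ * + 1 + (weight 0 * + 1 + (weight 1 * + 0 + + 0)))
      ≡⟨ cong (λ w → K + T * + 0 + (κ * + 1 + (w * + 1 + (weight 1 * + 0 + + 0)))) (coef-0 β) ⟩
    K + T * + 0 + (κ * + 1 + (- K * + 1 + (weight 1 * + 0 + + 0)))
      ≡⟨ identity β (weight 1) ⟩
    κ ∎
    where
    open ≡-Reasoning
    K = β * β - + 3 * β
    T = + 2 * (+ 1 - β)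
    identity : ∀ β w₁ → let K = β * β - + 3 * β ; κ = + 2 * (β - + 1) * (β - + 1) in
      K + + 2 * (+ 1 - β) * + 0 + (κ * + 1 + (- K * + 1 + (w₁ * + 0 + + 0))) ≡ κ
    identity = solve-∀

  Z-1 : Z 1 ≡ κ
  Z-1 = begin
    Z 1
      ≡⟨ cong₂ (λ x s → K + T * + 1 + (κ * x + (weight 0 * x + (weight 1 * + 1 + s)))) F-2
              (Σ<-zero c λ { zero → ℤ.*-zeroʳ (weight 2) ; (suc j) → ℤ.*-zeroʳ (weight (3 ℕ.+ j)) }) ⟩
    K + T * + 1 + (κ * + 1 + (weight 0 * + 1 + (weight 1 * + 1 + + 0)))
      ≡⟨ cong₂ (λ w₀ w₁ → K + T * + 1 + (κ * + 1 + (w₀ * + 1 + (w₁ * + 1 + + 0)))) (coef-0 β) (coef-1 β) ⟩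
    K + T * + 1 + (κ * + 1 + (- K * + 1 + (+ 2 * (β - + 1) * + 1 + + 0)))
      ≡⟨ identity β ⟩
    κ ∎
    where
    open ≡-Reasoning
    K = β * β - + 3 * β
    T = + 2 * (+ 1 - β)
    F-2 : f (+ 2) ≡ + 1
    F-2 = cong (λ xs → + (1 ℕ.+ (0 ℕ.+ sum xs))) (take-[] c)
    identity : ∀ β → let K = β * β - + 3 * β ; κ = + 2 * (β - + 1) * (β - + 1) in
      K + + 2 * (+ 1 - β) * + 1 + (κ * + 1 + (- K * + 1 + (+ 2 * (β - + 1) * + 1 + + 0))) ≡ κ
    identity = solve-∀

  module _ (a : ℕ → ℕ) (a-0 : a 0 ≡ 1) (a-suc : ∀ n → a (suc n) ≡ a n ℕ.+ ΣF n) where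

    a-second-difference : ∀ n → + a (2 ℕ.+ n) ≡ + 2 * + a (1 ℕ.+ n) - + a n + f (+ suc n)
    a-second-difference n rewrite a-suc (suc n) | a-suc n
      | ℤ.pos-+ (a n ℕ.+ ΣF n) (ΣF n ℕ.+ Fℕ b (suc n)) | ℤ.pos-+ (a n) (ΣF n) | ℤ.pos-+ (ΣF n) (Fℕ b (suc n)) =
      identity (+ a n) (+ ΣF n) (+ Fℕ b (suc n))
      where
      identity : ∀ x y z → (x + y) + (y + z) ≡ + 2 * (x + y) - x + z
      identity = solve-∀

    Z≡κa : ∀ n → Z n ≡ κ * + a n
    Z≡κa = second-difference-unique Z (λ n → κ * + a n) (λ n → κ * f (+ suc n))
      (trans Z-0 (trans (sym (ℤ.*-identityʳ κ)) (cong (λ x → κ * + x) (sym a-0))))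
      (trans Z-1 (trans (sym (ℤ.*-identityʳ κ)) (cong (λ x → κ * + x) (sym (trans (a-suc 0) (cong (ℕ._+ 0) a-0))))))
      Z-second-difference
      (λ n → trans (cong (κ *_) (a-second-difference n)) (scale κ (+ a (1 ℕ.+ n)) (+ a n) (f (+ suc n))))
      where
      scale : ∀ k x y z → k * (+ 2 * x - y + z) ≡ + 2 * (k * x) - k * y + k * z
      scale = solve-∀

module RationalEmbedding where
  open import Data.Integer using (_+_; _-_; _*_; -_)
  open IntegerSums using (Σ<)

  private
    toℚᵘ-ℤ→ℚ : ∀ z → ℚ.toℚᵘ (ℤ→ℚ z) ℚᵘ.≃ mkℚᵘ z 0
    toℚᵘ-ℤ→ℚ z = toℚᵘ-fromℚᵘ (mkℚᵘ z 0)

  ℤ→ℚ-homo-+ : ∀ x y → ℤ→ℚ (x + y) ≡ ℤ→ℚ x ℚ.+ ℤ→ℚ y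
  ℤ→ℚ-homo-+ x y = toℚᵘ-injective (ℚᵘ.≃-trans (toℚᵘ-ℤ→ℚ (x + y)) (ℚᵘ.≃-trans (*≡* (identity x y))
    (ℚᵘ.≃-sym (ℚᵘ.≃-trans (toℚᵘ-homo-+ (ℤ→ℚ x) (ℤ→ℚ y)) (ℚᵘ.+-cong (toℚᵘ-ℤ→ℚ x) (toℚᵘ-ℤ→ℚ y))))))
    where
    identity : ∀ x y → (x + y) * + 1 ≡ (x * + 1 + y * + 1) * + 1
    identity = solve-∀

  ℤ→ℚ-homo-* : ∀ x y → ℤ→ℚ (x * y) ≡ ℤ→ℚ x ℚ.* ℤ→ℚ y
  ℤ→ℚ-homo-* x y = toℚᵘ-injective (ℚᵘ.≃-trans (toℚᵘ-ℤ→ℚ (x * y)) (ℚᵘ.≃-trans (*≡* refl)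
    (ℚᵘ.≃-sym (ℚᵘ.≃-trans (toℚᵘ-homo-* (ℤ→ℚ x) (ℤ→ℚ y)) (ℚᵘ.*-cong (toℚᵘ-ℤ→ℚ x) (toℚᵘ-ℤ→ℚ y))))))

  ℤ→ℚ-homo‿- : ∀ x → ℤ→ℚ (- x) ≡ ℚ.- ℤ→ℚ x
  ℤ→ℚ-homo‿- x = toℚᵘ-injective (ℚᵘ.≃-trans (toℚᵘ-ℤ→ℚ (- x))
    (ℚᵘ.≃-sym (ℚᵘ.≃-trans (toℚᵘ-homo‿- (ℤ→ℚ x)) (ℚᵘ.-‿cong (toℚᵘ-ℤ→ℚ x)))))

  ℤ→ℚ-homo-− : ∀ x y → ℤ→ℚ (x - y) ≡ ℤ→ℚ x ℚ.- ℤ→ℚ y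
  ℤ→ℚ-homo-− x y = trans (ℤ→ℚ-homo-+ x (- y)) (cong (ℤ→ℚ x ℚ.+_) (ℤ→ℚ-homo‿- y))

  /-as-* : ∀ z k → z / suc k ≡ ℤ→ℚ z ℚ.* (+ 1 / suc k)
  /-as-* z k = toℚᵘ-injective (ℚᵘ.≃-trans (toℚᵘ-fromℚᵘ (mkℚᵘ z k)) (ℚᵘ.≃-trans (*≡* (identity z (+ suc k)))
    (ℚᵘ.≃-sym (ℚᵘ.≃-trans (toℚᵘ-homo-* (ℤ→ℚ z) (+ 1 / suc k)) (ℚᵘ.*-cong (toℚᵘ-ℤ→ℚ z) (toℚᵘ-fromℚᵘ (mkℚᵘ (+ 1) k)))))))
    where
    identity : ∀ z d → z * (+ 1 * d) ≡ (z * + 1) * d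
    identity = solve-∀

  1/n*n≡1 : ∀ k → (+ 1 / suc k) ℚ.* ℤ→ℚ (+ suc k) ≡ 1ℚ
  1/n*n≡1 k = toℚᵘ-injective (ℚᵘ.≃-trans (toℚᵘ-homo-* (+ 1 / suc k) (ℤ→ℚ (+ suc k)))
    (ℚᵘ.≃-trans (ℚᵘ.*-cong (toℚᵘ-fromℚᵘ (mkℚᵘ (+ 1) k)) (toℚᵘ-ℤ→ℚ (+ suc k))) (*≡* (identity (+ suc k)))))
    where
    identity : ∀ d → (+ 1 * d) * + 1 ≡ + 1 * (d * + 1)
    identity = solve-∀

  Σℚ-cong : ∀ is {u v : ℕ → ℚ} → (∀ i → u i ≡ v i) → Σℚ is u ≡ Σℚ is v
  Σℚ-cong [] eq = refl
  Σℚ-cong (i ∷ is) eq = cong₂ ℚ._+_ (eq i) (Σℚ-cong is eq)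

  Σℚ-scaled : ∀ (s : ℚ) L (p q : ℕ → ℕ) (u : ℕ → ℤ) →
    Σℚ (map p (applyUpTo q L)) (λ i → s ℚ.* ℤ→ℚ (u i)) ≡ s ℚ.* ℤ→ℚ (Σ< L (λ j → u (p (q j))))
  Σℚ-scaled s zero p q u = sym (ℚ.*-zeroʳ s)
  Σℚ-scaled s (suc L) p q u = begin
    s ℚ.* ℤ→ℚ (u (p (q 0))) ℚ.+ Σℚ (map p (applyUpTo (λ j → q (suc j)) L)) (λ i → s ℚ.* ℤ→ℚ (u i))
      ≡⟨ cong (s ℚ.* ℤ→ℚ (u (p (q 0))) ℚ.+_) (Σℚ-scaled s L p (λ j → q (suc j)) u) ⟩
    s ℚ.* ℤ→ℚ (u (p (q 0))) ℚ.+ s ℚ.* ℤ→ℚ rest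
      ≡⟨ sym (ℚ.*-distribˡ-+ s _ _) ⟩
    s ℚ.* (ℤ→ℚ (u (p (q 0))) ℚ.+ ℤ→ℚ rest)
      ≡⟨ cong (s ℚ.*_) (sym (ℤ→ℚ-homo-+ (u (p (q 0))) rest)) ⟩
    s ℚ.* ℤ→ℚ (u (p (q 0)) + rest) ∎
    where
    open ≡-Reasoning
    rest = Σ< L (λ j → u (p (q (suc j))))

module ClosedFormℚ (c : ℕ) where
  open import Data.Integer using (_+_; _-_; _*_; -_)
  open Combinatorics using (_C_)
  open IntegerSums
  open Weights
  open RationalEmbedding
  open ClosedFormℤ c

  ½ : ℚ
  ½ = + 1 / 2

  summand : ℕ → ℕ → ℚ
  summand n i =
    ( (ℤ→ℚ ((+ 1 - + b) * + (i C 2)))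
      ℚ.+ (((+ (b ℕ.* b) - + b - + 2) / 2) ℚ.* ℕ→ℚ i)
      ℚ.- ((+ (b ℕ.* b) - + (3 ℕ.* b)) / 2) )
    ℚ.* ℕ→ℚ (F b (+ n - + i + + 1))

  closedForm : ℕ → ℚ
  closedForm n =
    ((+ (b ℕ.* b) - + (3 ℕ.* b)) / 2)
    ℚ.+ (ℤ→ℚ ((+ 1 - + b) * + n))
    ℚ.+ ( (((+ (b ℕ.* b) - + b + + 2) / 2) ℚ.* ℕ→ℚ (F b (+ (n ℕ.+ 1))))
          ℚ.+ (ℤ→ℚ (+ b - + 1) ℚ.* ℕ→ℚ (F b (+ n)))
          ℚ.+ Σℚ (map (λ j → 2 ℕ.+ j) (upTo (b ℕ.∸ 2))) (summand n))

  summand-weight : ∀ n i → summand n i ≡ ½ ℚ.* ℤ→ℚ (weight i * f (+ suc n - + i))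
  summand-weight n i = begin
    summand n i
      ≡⟨ cong₂ (λ u v → (ℤ→ℚ Cᵢ ℚ.+ u ℚ.* ℤ→ℚ (+ i) ℚ.- v) ℚ.* ℤ→ℚ Fᵢ) (/-as-* X 1) (/-as-* K 1) ⟩
    (ℤ→ℚ Cᵢ ℚ.+ (ℤ→ℚ X ℚ.* ½) ℚ.* ℤ→ℚ (+ i) ℚ.- ℤ→ℚ K ℚ.* ½) ℚ.* ℤ→ℚ Fᵢ
      ≡⟨ solve 5 (λ γ ξ ι κ φ → (γ :+ (ξ :* con ½) :* ι :- κ :* con ½) :* φ
                               := con ½ :* ((con (ℤ→ℚ (+ 2)) :* γ :+ ξ :* ι :- κ) :* φ)) refl
               (ℤ→ℚ Cᵢ) (ℤ→ℚ X) (ℤ→ℚ (+ i)) (ℤ→ℚ K) (ℤ→ℚ Fᵢ) ⟩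
    ½ ℚ.* ((ℤ→ℚ (+ 2) ℚ.* ℤ→ℚ Cᵢ ℚ.+ ℤ→ℚ X ℚ.* ℤ→ℚ (+ i) ℚ.- ℤ→ℚ K) ℚ.* ℤ→ℚ Fᵢ)
      ≡⟨ cong (½ ℚ.*_) (sym ι-expand) ⟩
    ½ ℚ.* ℤ→ℚ ((+ 2 * Cᵢ + X * + i - K) * Fᵢ)
      ≡⟨ cong (λ z → ½ ℚ.* ℤ→ℚ z) (cong₂ _*_ (coef-binomial b i) (cong f (shift (+ n) (+ i)))) ⟩
    ½ ℚ.* ℤ→ℚ (weight i * f (+ suc n - + i)) ∎
    where
    open ≡-Reasoning
    open ℚ-Solver
    Cᵢ = (+ 1 - + b) * + (i C 2)
    X = + (b ℕ.* b) - + b - + 2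
    K = + (b ℕ.* b) - + (3 ℕ.* b)
    Fᵢ = + F b (+ n - + i + + 1)
    ι-expand : ℤ→ℚ ((+ 2 * Cᵢ + X * + i - K) * Fᵢ)
             ≡ (ℤ→ℚ (+ 2) ℚ.* ℤ→ℚ Cᵢ ℚ.+ ℤ→ℚ X ℚ.* ℤ→ℚ (+ i) ℚ.- ℤ→ℚ K) ℚ.* ℤ→ℚ Fᵢ
    ι-expand = begin
      ℤ→ℚ ((+ 2 * Cᵢ + X * + i - K) * Fᵢ)                   ≡⟨ ℤ→ℚ-homo-* (+ 2 * Cᵢ + X * + i - K) Fᵢ ⟩
      ℤ→ℚ (+ 2 * Cᵢ + X * + i - K) ℚ.* ℤ→ℚ Fᵢ                ≡⟨ cong (ℚ._* ℤ→ℚ Fᵢ) (ℤ→ℚ-homo-− (+ 2 * Cᵢ + X * + i) K) ⟩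
      (ℤ→ℚ (+ 2 * Cᵢ + X * + i) ℚ.- ℤ→ℚ K) ℚ.* ℤ→ℚ Fᵢ        ≡⟨ cong (λ z → (z ℚ.- ℤ→ℚ K) ℚ.* ℤ→ℚ Fᵢ) (ℤ→ℚ-homo-+ (+ 2 * Cᵢ) (X * + i)) ⟩
      (ℤ→ℚ (+ 2 * Cᵢ) ℚ.+ ℤ→ℚ (X * + i) ℚ.- ℤ→ℚ K) ℚ.* ℤ→ℚ Fᵢ
        ≡⟨ cong₂ (λ u v → (u ℚ.+ v ℚ.- ℤ→ℚ K) ℚ.* ℤ→ℚ Fᵢ) (ℤ→ℚ-homo-* (+ 2) Cᵢ) (ℤ→ℚ-homo-* X (+ i)) ⟩
      (ℤ→ℚ (+ 2) ℚ.* ℤ→ℚ Cᵢ ℚ.+ ℤ→ℚ X ℚ.* ℤ→ℚ (+ i) ℚ.- ℤ→ℚ K) ℚ.* ℤ→ℚ Fᵢ ∎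
    shift : ∀ x y → x - y + + 1 ≡ (+ 1 + x) - y
    shift = solve-∀

  private
    G-tail : ℕ → ℤ
    G-tail n = Σ< c (λ j → weight (2 ℕ.+ j) * f (+ suc n - + (2 ℕ.+ j)))

  Z-expanded : ∀ n →
    (+ (b ℕ.* b) - + (3 ℕ.* b)) + + 2 * ((+ 1 - + b) * + n)
      + ((+ (b ℕ.* b) - + b + + 2) * + F b (+ (n ℕ.+ 1)) + + 2 * ((+ b - + 1) * + F b (+ n)) + G-tail n)
    ≡ Z n
  Z-expanded n rewrite ℤ.pos-* b b | ℤ.pos-* 3 b | ℕ.+-comm n 1 = begin
    K + + 2 * ((+ 1 - β) * + n) + ((β * β - β + + 2) * f₁ + + 2 * ((β - + 1) * f₀) + G-tail n)
      ≡⟨ identity β (+ n) f₁ f₀ (G-tail n) ⟩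
    K + + 2 * (+ 1 - β) * + n + (κ * f₁ + (- K * f₁ + (+ 2 * (β - + 1) * f₀ + G-tail n)))
      ≡⟨ cong₂ (λ w₀ x → K + + 2 * (+ 1 - β) * + n + (κ * f₁ + (w₀ * x + (+ 2 * (β - + 1) * f₀ + G-tail n))))
               (sym (coef-0 β)) (cong f (sym (ℤ.+-identityʳ (+ suc n)))) ⟩
    K + + 2 * (+ 1 - β) * + n + (κ * f₁ + (weight 0 * f (+ suc n - + 0) + (+ 2 * (β - + 1) * f₀ + G-tail n)))
      ≡⟨ cong (λ w₁ → K + + 2 * (+ 1 - β) * + n + (κ * f₁ + (weight 0 * f (+ suc n - + 0) + (w₁ * f₀ + G-tail n))))
              (sym (coef-1 β)) ⟩
    Z n ∎
    where
    open ≡-Reasoning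
    K = β * β - + 3 * β
    f₁ = f (+ suc n)
    f₀ = f (+ n)
    identity : ∀ β x f₁ f₀ s → let K = β * β - + 3 * β in
      K + + 2 * ((+ 1 - β) * x) + ((β * β - β + + 2) * f₁ + + 2 * ((β - + 1) * f₀) + s)
      ≡ K + + 2 * (+ 1 - β) * x + (+ 2 * (β - + 1) * (β - + 1) * f₁ + (- K * f₁ + (+ 2 * (β - + 1) * f₀ + s)))
    identity = solve-∀

  closedForm≡½Z : ∀ n → closedForm n ≡ ½ ℚ.* ℤ→ℚ (Z n)
  closedForm≡½Z n = begin
    closedForm n
      ≡⟨ cong (λ u → (K / 2) ℚ.+ ℤ→ℚ A ℚ.+ ((X / 2) ℚ.* ℤ→ℚ F₁ ℚ.+ ℤ→ℚ B ℚ.* ℤ→ℚ F₀ ℚ.+ u)) summands ⟩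
    (K / 2) ℚ.+ ℤ→ℚ A ℚ.+ ((X / 2) ℚ.* ℤ→ℚ F₁ ℚ.+ ℤ→ℚ B ℚ.* ℤ→ℚ F₀ ℚ.+ ½ ℚ.* ℤ→ℚ (G-tail n))
      ≡⟨ cong₂ (λ u v → u ℚ.+ ℤ→ℚ A ℚ.+ (v ℚ.* ℤ→ℚ F₁ ℚ.+ ℤ→ℚ B ℚ.* ℤ→ℚ F₀ ℚ.+ ½ ℚ.* ℤ→ℚ (G-tail n))) (/-as-* K 1) (/-as-* X 1) ⟩
    ℤ→ℚ K ℚ.* ½ ℚ.+ ℤ→ℚ A ℚ.+ ((ℤ→ℚ X ℚ.* ½) ℚ.* ℤ→ℚ F₁ ℚ.+ ℤ→ℚ B ℚ.* ℤ→ℚ F₀ ℚ.+ ½ ℚ.* ℤ→ℚ (G-tail n))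
      ≡⟨ solve 7 (λ κ α ξ φ₁ β φ₀ σ → κ :* con ½ :+ α :+ ((ξ :* con ½) :* φ₁ :+ β :* φ₀ :+ con ½ :* σ)
                 := con ½ :* (κ :+ con (ℤ→ℚ (+ 2)) :* α :+ (ξ :* φ₁ :+ con (ℤ→ℚ (+ 2)) :* (β :* φ₀) :+ σ))) refl
               (ℤ→ℚ K) (ℤ→ℚ A) (ℤ→ℚ X) (ℤ→ℚ F₁) (ℤ→ℚ B) (ℤ→ℚ F₀) (ℤ→ℚ (G-tail n)) ⟩
    ½ ℚ.* (ℤ→ℚ K ℚ.+ ℤ→ℚ (+ 2) ℚ.* ℤ→ℚ A ℚ.+ (ℤ→ℚ X ℚ.* ℤ→ℚ F₁ ℚ.+ ℤ→ℚ (+ 2) ℚ.* (ℤ→ℚ B ℚ.* ℤ→ℚ F₀) ℚ.+ ℤ→ℚ (G-tail n)))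
      ≡⟨ cong (½ ℚ.*_) (sym ι-expand) ⟩
    ½ ℚ.* ℤ→ℚ (K + + 2 * A + (X * F₁ + + 2 * (B * F₀) + G-tail n))
      ≡⟨ cong (λ z → ½ ℚ.* ℤ→ℚ z) (Z-expanded n) ⟩
    ½ ℚ.* ℤ→ℚ (Z n) ∎
    where
    open ≡-Reasoning
    open ℚ-Solver
    K = + (b ℕ.* b) - + (3 ℕ.* b)
    A = (+ 1 - + b) * + n
    X = + (b ℕ.* b) - + b + + 2
    B = + b - + 1
    F₁ = + F b (+ (n ℕ.+ 1))
    F₀ = + F b (+ n)
    summands : Σℚ (map (λ j → 2 ℕ.+ j) (upTo c)) (summand n) ≡ ½ ℚ.* ℤ→ℚ (G-tail n)
    summands = trans (Σℚ-cong (map (λ j → 2 ℕ.+ j) (upTo c)) (summand-weight n))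
                     (Σℚ-scaled ½ c (λ j → 2 ℕ.+ j) (λ j → j) (λ i → weight i * f (+ suc n - + i)))
    ι-expand : ℤ→ℚ (K + + 2 * A + (X * F₁ + + 2 * (B * F₀) + G-tail n))
             ≡ ℤ→ℚ K ℚ.+ ℤ→ℚ (+ 2) ℚ.* ℤ→ℚ A ℚ.+ (ℤ→ℚ X ℚ.* ℤ→ℚ F₁ ℚ.+ ℤ→ℚ (+ 2) ℚ.* (ℤ→ℚ B ℚ.* ℤ→ℚ F₀) ℚ.+ ℤ→ℚ (G-tail n))
    ι-expand = begin
      ℤ→ℚ (K + + 2 * A + (X * F₁ + + 2 * (B * F₀) + G-tail n))
        ≡⟨ ℤ→ℚ-homo-+ (K + + 2 * A) (X * F₁ + + 2 * (B * F₀) + G-tail n) ⟩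
      ℤ→ℚ (K + + 2 * A) ℚ.+ ℤ→ℚ (X * F₁ + + 2 * (B * F₀) + G-tail n)
        ≡⟨ cong₂ ℚ._+_ (trans (ℤ→ℚ-homo-+ K (+ 2 * A)) (cong (ℤ→ℚ K ℚ.+_) (ℤ→ℚ-homo-* (+ 2) A)))
                       (trans (ℤ→ℚ-homo-+ (X * F₁ + + 2 * (B * F₀)) (G-tail n)) (cong (ℚ._+ ℤ→ℚ (G-tail n)) (ℤ→ℚ-homo-+ (X * F₁) (+ 2 * (B * F₀))))) ⟩
      ℤ→ℚ K ℚ.+ ℤ→ℚ (+ 2) ℚ.* ℤ→ℚ A ℚ.+ (ℤ→ℚ (X * F₁) ℚ.+ ℤ→ℚ (+ 2 * (B * F₀)) ℚ.+ ℤ→ℚ (G-tail n))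
        ≡⟨ cong₂ (λ u v → ℤ→ℚ K ℚ.+ ℤ→ℚ (+ 2) ℚ.* ℤ→ℚ A ℚ.+ (u ℚ.+ v ℚ.+ ℤ→ℚ (G-tail n)))
                 (ℤ→ℚ-homo-* X F₁) (trans (ℤ→ℚ-homo-* (+ 2) (B * F₀)) (cong (ℤ→ℚ (+ 2) ℚ.*_) (ℤ→ℚ-homo-* B F₀))) ⟩
      ℤ→ℚ K ℚ.+ ℤ→ℚ (+ 2) ℚ.* ℤ→ℚ A ℚ.+ (ℤ→ℚ X ℚ.* ℤ→ℚ F₁ ℚ.+ ℤ→ℚ (+ 2) ℚ.* (ℤ→ℚ B ℚ.* ℤ→ℚ F₀) ℚ.+ ℤ→ℚ (G-tail n)) ∎

  module _ (a : ℕ → ℕ) (a-0 : a 0 ≡ 1) (a-suc : ∀ n → a (suc n) ≡ a n ℕ.+ ΣF n) where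

    a-closed-form : ∀ n → ℕ→ℚ (a n) ≡ ((+ 1 / suc c) ℚ.* (+ 1 / suc c)) ℚ.* closedForm n
    a-closed-form n = sym (begin
      (r ℚ.* r) ℚ.* closedForm n
        ≡⟨ cong ((r ℚ.* r) ℚ.*_) (closedForm≡½Z n) ⟩
      (r ℚ.* r) ℚ.* (½ ℚ.* ℤ→ℚ (Z n))
        ≡⟨ cong (λ z → (r ℚ.* r) ℚ.* (½ ℚ.* ℤ→ℚ z)) (trans (Z≡κa a a-0 a-suc n) (cong (_* + a n) (κ-value (+ suc c)))) ⟩
      (r ℚ.* r) ℚ.* (½ ℚ.* ℤ→ℚ (+ 2 * s * s * + a n))
        ≡⟨ cong (λ z → (r ℚ.* r) ℚ.* (½ ℚ.* z)) ι-expand ⟩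
      (r ℚ.* r) ℚ.* (½ ℚ.* (ℤ→ℚ (+ 2) ℚ.* ℤ→ℚ s ℚ.* ℤ→ℚ s ℚ.* ℤ→ℚ (+ a n)))
        ≡⟨ solve 3 (λ ρ σ α → (ρ :* ρ) :* (con ½ :* (con (ℤ→ℚ (+ 2)) :* σ :* σ :* α)) := (ρ :* σ) :* (ρ :* σ) :* α) refl
                 r (ℤ→ℚ s) (ℤ→ℚ (+ a n)) ⟩
      (r ℚ.* ℤ→ℚ s) ℚ.* (r ℚ.* ℤ→ℚ s) ℚ.* ℤ→ℚ (+ a n)
        ≡⟨ cong (λ z → z ℚ.* z ℚ.* ℤ→ℚ (+ a n)) (1/n*n≡1 c) ⟩
      1ℚ ℚ.* 1ℚ ℚ.* ℤ→ℚ (+ a n)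
        ≡⟨ solve 1 (λ α → con 1ℚ :* con 1ℚ :* α := α) refl (ℤ→ℚ (+ a n)) ⟩
      ℕ→ℚ (a n) ∎)
      where
      open ≡-Reasoning
      open ℚ-Solver
      r = + 1 / suc c
      s = + suc c
      κ-value : ∀ x → + 2 * ((+ 1 + x) - + 1) * ((+ 1 + x) - + 1) ≡ + 2 * x * x
      κ-value = solve-∀
      ι-expand : ℤ→ℚ (+ 2 * s * s * + a n) ≡ ℤ→ℚ (+ 2) ℚ.* ℤ→ℚ s ℚ.* ℤ→ℚ s ℚ.* ℤ→ℚ (+ a n)
      ι-expand = trans (ℤ→ℚ-homo-* (+ 2 * s * s) (+ a n)) (cong (ℚ._* ℤ→ℚ (+ a n))
                   (trans (ℤ→ℚ-homo-* (+ 2 * s) s) (cong (ℚ._* ℤ→ℚ s) (ℤ→ℚ-homo-* (+ 2) s))))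

module PowerSeries where
  open import Data.Integer using (_+_; _-_; _*_)
  open IntegerSums using (Σ<; Σ<-suc; Σ<-zero)

  coeff-≥length : ∀ xs t → length xs ≤ t → coeff xs t ≡ + 0
  coeff-≥length [] zero _ = refl
  coeff-≥length [] (suc t) _ = refl
  coeff-≥length (x ∷ xs) (suc t) (s≤s le) = coeff-≥length xs t le

  coeff-applyUpTo : ∀ (g : ℕ → ℤ) L → (∀ j → L ≤ j → g j ≡ + 0) → ∀ j → coeff (applyUpTo g L) j ≡ g j
  coeff-applyUpTo g zero vanish j = sym (vanish j z≤n)
  coeff-applyUpTo g (suc L) vanish zero = refl
  coeff-applyUpTo g (suc L) vanish (suc j) = coeff-applyUpTo (g ∘ suc) L (λ j → vanish (suc j) ∘ s≤s) j

  extendByZero : (ℕ → ℤ) → ℤ → ℤ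
  extendByZero h (+ m) = h m
  extendByZero h -[1+ _ ] = + 0

  convolve : List ℤ → ℤ → (ℤ → ℤ) → ℤ
  convolve [] z H = + 0
  convolve (x ∷ xs) z H = x * H z + convolve xs (z - + 1) H

  convolve-negative : ∀ xs k h → convolve xs -[1+ k ] (extendByZero h) ≡ + 0
  convolve-negative [] k h = refl
  convolve-negative (x ∷ xs) k h = cong₂ _+_ (ℤ.*-zeroʳ x) (convolve-negative xs _ h)

  convolve-zeros++ : ∀ k xs z H → convolve (replicate k (+ 0) ++ xs) z H ≡ convolve xs (z - + k) H
  convolve-zeros++ zero xs z H = cong (λ w → convolve xs w H) (sym (ℤ.+-identityʳ z))
  convolve-zeros++ (suc k) xs z H =
    trans (ℤ.+-identityˡ _) (trans (convolve-zeros++ k xs (z - + 1) H) (cong (λ w → convolve xs w H) (shift z (+ k))))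
    where
    shift : ∀ x y → x - + 1 - y ≡ x - (+ 1 + y)
    shift = solve-∀

  Σℤ≤-cong : ∀ n {g h : ℕ → ℤ} → (∀ j → g j ≡ h j) → Σℤ≤ n g ≡ Σℤ≤ n h
  Σℤ≤-cong zero eq = eq 0
  Σℤ≤-cong (suc n) eq = cong₂ _+_ (Σℤ≤-cong n eq) (eq (suc n))

  Σℤ≤≡Σ< : ∀ n g → Σℤ≤ n g ≡ Σ< (suc n) g
  Σℤ≤≡Σ< zero g = sym (ℤ.+-identityʳ (g 0))
  Σℤ≤≡Σ< (suc n) g = trans (cong (_+ g (suc n)) (Σℤ≤≡Σ< n g)) (sym (Σ<-suc (suc n) g))

  Σℤ≤-convolve : ∀ cs n h → Σℤ≤ n (λ j → coeff cs j * h (n ∸ j)) ≡ convolve cs (+ n) (extendByZero h)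
  Σℤ≤-convolve cs n h = trans (Σℤ≤≡Σ< n _) (Σ<-convolve cs n)
    where
    Σ<-convolve : ∀ cs n → Σ< (suc n) (λ j → coeff cs j * h (n ∸ j)) ≡ convolve cs (+ n) (extendByZero h)
    Σ<-convolve [] n = Σ<-zero (suc n) (λ _ → refl)
    Σ<-convolve (x ∷ xs) zero = cong (_+_ (x * h 0)) (sym (convolve-negative xs 0 h))
    Σ<-convolve (x ∷ xs) (suc n) = cong (_+_ (x * h (suc n))) (Σ<-convolve xs n)

  δ : ℤ → ℤ
  δ (+ zero) = + 1
  δ (+ suc _) = + 0
  δ -[1+ _ ] = + 0

  convolve-δ : ∀ cs z → convolve cs z δ ≡ extendByZero (coeff cs) z
  convolve-δ [] (+ n) = sym (coeff-≥length [] n z≤n)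
  convolve-δ [] -[1+ n ] = refl
  convolve-δ (x ∷ xs) (+ zero) = trans (cong₂ _+_ (ℤ.*-identityʳ x) (convolve-δ xs -[1+ 0 ])) (ℤ.+-identityʳ x)
  convolve-δ (x ∷ xs) (+ suc n) = trans (cong₂ _+_ (ℤ.*-zeroʳ x) (convolve-δ xs (+ n))) (ℤ.+-identityˡ _)
  convolve-δ (x ∷ xs) -[1+ n ] = cong₂ _+_ (ℤ.*-zeroʳ x) (convolve-δ xs (-[1+ n ] - + 1))

module Denominator (c : ℕ) where
  open import Data.Integer using (_+_; _*_; -_)
  open PowerSeries

  b : ℕ
  b = 2 ℕ.+ c

  -- (1 - x)² (1 - x - ⋯ - x^b), expanded
  denominator : List ℤ
  denominator = + 1 ∷ -[1+ 2 ] ∷ + 2 ∷ replicate c (+ 0) ++ + 1 ∷ -[1+ 0 ] ∷ []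

  private
    Q : List ℤ
    Q = + 1 ∷ replicate b (- + 1)

    square : List ℤ
    square = + 1 ∷ -[1+ 1 ] ∷ + 1 ∷ + 0 ∷ []

    product : ℕ → ℤ
    product n = Σℤ≤ n (λ j → coeff square j * coeff Q (n ∸ j))

    Q-second-difference : ∀ d m → let r = coeff (replicate (2 ℕ.+ d) (- + 1)) in
      + 1 * r (2 ℕ.+ m) + (-[1+ 1 ] * r (1 ℕ.+ m) + (+ 1 * r m + + 0))
      ≡ coeff (replicate d (+ 0) ++ + 1 ∷ -[1+ 0 ] ∷ []) m
    Q-second-difference zero zero = refl
    Q-second-difference zero (suc zero) = refl
    Q-second-difference zero (suc (suc m)) = refl
    Q-second-difference (suc d) zero = refl
    Q-second-difference (suc d) (suc m) = Q-second-difference d m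

    product≡denominator : ∀ j → product j ≡ coeff denominator j
    product≡denominator j = trans (Σℤ≤-convolve square j (coeff Q)) (go j)
      where
      go : ∀ j → convolve square (+ j) (extendByZero (coeff Q)) ≡ coeff denominator j
      go 0 = refl
      go 1 = refl
      go 2 = refl
      go (suc (suc (suc m))) = Q-second-difference c m

  -- denPoly b unfolds to applyUpTo product (4 + length Q).
  coeff-denPoly : ∀ j → coeff (denPoly b) j ≡ coeff denominator j
  coeff-denPoly j = trans (coeff-applyUpTo product (4 ℕ.+ length Q) vanish j) (product≡denominator j)
    where
    short : length denominator ≤ 4 ℕ.+ length Q
    short rewrite List.length-++ (replicate c (+ 0)) {+ 1 ∷ -[1+ 0 ] ∷ []} | List.length-replicate c {+ 0} | List.length-replicate b { x = - + 1 } =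
      s≤s (s≤s (s≤s (ℕ.≤-trans (ℕ.≤-reflexive (ℕ.+-comm c 2)) (ℕ.m≤n+m (2 ℕ.+ c) 2))))
    vanish : ∀ j → 4 ℕ.+ length Q ≤ j → product j ≡ + 0
    vanish j le = trans (product≡denominator j) (coeff-≥length denominator j (ℕ.≤-trans short le))

module GeneratingFunction (c : ℕ) (a : ℕ → ℕ) (a-0 : a 0 ≡ 1) (a-suc : ∀ n → a (suc n) ≡ a n ℕ.+ ClosedFormℤ.ΣF c n) where
  open import Data.Integer using (_+_; _-_; _*_)
  open IntegerSums
  open Fibonacci
  open PowerSeries
  open ClosedFormℤ c using (b; f; ΣF)
  open Denominator c using (denominator; coeff-denPoly)

  U : ℤ → ℤ
  U = extendByZero (λ k → + ΣF k)

  A : ℤ → ℤ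
  A = extendByZero (λ k → + a k)

  U-step : ∀ z → U z ≡ U (z - + 1) + f z
  U-step (+ zero) = refl
  U-step (+ suc k) = ℤ.pos-+ (ΣF k) (Fℕ b (suc k))
  U-step -[1+ k ] = refl

  F-window : ∀ L z → Σ< L (λ k → f (z - + k)) ≡ U z - U (z - + L)
  F-window zero z = sym (trans (cong (λ w → U z - U w) (ℤ.+-identityʳ z)) (ℤ.+-inverseʳ (U z)))
  F-window (suc L) z = begin
    Σ< (suc L) (λ k → f (z - + k))                            ≡⟨ Σ<-suc L (λ k → f (z - + k)) ⟩
    Σ< L (λ k → f (z - + k)) + f (z - + L)                    ≡⟨ cong (_+ f (z - + L)) (F-window L z) ⟩
    U z - U (z - + L) + f (z - + L)                           ≡⟨ cong (λ w → U z - w + f (z - + L)) (U-step (z - + L)) ⟩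
    U z - (U (z - + L - + 1) + f (z - + L)) + f (z - + L)     ≡⟨ cancel (U z) (U (z - + L - + 1)) (f (z - + L)) ⟩
    U z - U (z - + L - + 1)                                   ≡⟨ cong (λ w → U z - U w) (shift z (+ L)) ⟩
    U z - U (z - + suc L) ∎
    where
    open ≡-Reasoning
    cancel : ∀ x y w → x - (y + w) + w ≡ x - y
    cancel = solve-∀
    shift : ∀ x l → x - l - + 1 ≡ x - (+ 1 + l)
    shift = solve-∀

  F-jump : ∀ z → f z ≡ U (z - + 1) - U (z - + 1 - + b) + δ (z - + 1)
  F-jump (+ zero) = refl
  F-jump (+ suc zero) = refl
  F-jump (+ suc (suc m)) = trans (F-recurrence b m) (trans (F-window b (+ suc m)) (sym (ℤ.+-identityʳ _)))
  F-jump -[1+ k ] = refl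

  A-jump : ∀ z → A z ≡ A (z - + 1) + U (z - + 1) + δ z
  A-jump (+ zero) = cong +_ a-0
  A-jump (+ suc k) = trans (cong +_ (a-suc k)) (trans (ℤ.pos-+ (a k) (ΣF k)) (sym (ℤ.+-identityʳ _)))
  A-jump -[1+ k ] = refl

  denominator-annihilates : ∀ z → convolve denominator z A ≡ convolve (numPoly b) z δ
  denominator-annihilates z = begin
    convolve denominator z A
      ≡⟨ cong (λ t → + 1 * A z + (-[1+ 2 ] * A z₁ + (+ 2 * A z₂ + t))) (convolve-zeros++ c (+ 1 ∷ -[1+ 0 ] ∷ []) z₃ A) ⟩
    + 1 * A z + (-[1+ 2 ] * A z₁ + (+ 2 * A z₂ + (+ 1 * A w + (-[1+ 0 ] * A w₁ + + 0))))
      ≡⟨ telescope (A z) (A z₁) (A z₂) (A w) (A w₁) (U z₁) (U z₂) (U w₁) (f z₁) (δ z) (δ z₁) (δ z₂) (δ w)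
                   (A-jump z) (A-jump z₁) (A-jump w) (U-step z₁)
                   (trans (F-jump z₁) (cong (λ y → U z₂ - U y + δ z₂) (shift z₂ (+ c)))) ⟩
    + 1 * δ z + (-[1+ 1 ] * δ z₁ + (+ 1 * δ z₂ + (+ 1 * δ w + + 0)))
      ≡⟨ cong (λ t → + 1 * δ z + (-[1+ 1 ] * δ z₁ + (+ 1 * δ z₂ + t))) (sym (convolve-zeros++ c (+ 1 ∷ []) z₃ δ)) ⟩
    convolve (numPoly b) z δ ∎
    where
    open ≡-Reasoning
    z₁ = z - + 1
    z₂ = z₁ - + 1
    z₃ = z₂ - + 1
    w = z₃ - + c
    w₁ = w - + 1
    shift : ∀ x y → x - (+ 2 + y) ≡ x - + 1 - y - + 1
    shift = solve-∀
    telescope : ∀ Az Az₁ Az₂ Aw Aw₁ Uz₁ Uz₂ Uw₁ fz₁ δz δz₁ δz₂ δw →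
      Az ≡ Az₁ + Uz₁ + δz → Az₁ ≡ Az₂ + Uz₂ + δz₁ → Aw ≡ Aw₁ + Uw₁ + δw → Uz₁ ≡ Uz₂ + fz₁ → fz₁ ≡ Uz₂ - Uw₁ + δz₂ →
      + 1 * Az + (-[1+ 2 ] * Az₁ + (+ 2 * Az₂ + (+ 1 * Aw + (-[1+ 0 ] * Aw₁ + + 0))))
      ≡ + 1 * δz + (-[1+ 1 ] * δz₁ + (+ 1 * δz₂ + (+ 1 * δw + + 0)))
    telescope _ _ Az₂ _ Aw₁ _ Uz₂ Uw₁ _ δz δz₁ δz₂ δw refl refl refl refl refl = identity Az₂ Aw₁ Uz₂ Uw₁ δz δz₁ δz₂ δw
      where
      identity : ∀ Az₂ Aw₁ Uz₂ Uw₁ δz δz₁ δz₂ δw →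
        + 1 * ((Az₂ + Uz₂ + δz₁) + (Uz₂ + (Uz₂ - Uw₁ + δz₂)) + δz)
          + (-[1+ 2 ] * (Az₂ + Uz₂ + δz₁) + (+ 2 * Az₂ + (+ 1 * (Aw₁ + Uw₁ + δw) + (-[1+ 0 ] * Aw₁ + + 0))))
        ≡ + 1 * δz + (-[1+ 1 ] * δz₁ + (+ 1 * δz₂ + (+ 1 * δw + + 0)))
      identity = solve-∀

  seriesEq : SeriesEq a (numPoly b) (denPoly b)
  seriesEq n = begin
    Σℤ≤ n (λ j → coeff (denPoly b) j * + a (n ∸ j))   ≡⟨ Σℤ≤-cong n (λ j → cong (_* + a (n ∸ j)) (coeff-denPoly j)) ⟩
    Σℤ≤ n (λ j → coeff denominator j * + a (n ∸ j))   ≡⟨ Σℤ≤-convolve denominator n (λ k → + a k) ⟩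
    convolve denominator (+ n) A                       ≡⟨ denominator-annihilates (+ n) ⟩
    convolve (numPoly b) (+ n) δ                       ≡⟨ convolve-δ (numPoly b) (+ n) ⟩
    coeff (numPoly b) n ∎
    where open ≡-Reasoning

module ListFacts where
  open import Data.Nat using (_+_)

  Pointwise-drop : ∀ {R : ℕ → ℕ → Set} D E {xs ys} → length D ≡ length E → Pointwise R (D ++ xs) (E ++ ys) → Pointwise R xs ys
  Pointwise-drop [] [] _ rel = rel
  Pointwise-drop (_ ∷ D) (_ ∷ E) eq (_ ∷ rel) = Pointwise-drop D E (ℕ.suc-injective eq) rel

  ⊆-++⁻ : ∀ {xs : List ℕ} X {Y} → xs ⊆ X ++ Y → Σ[ xs₁ ∈ List ℕ ] Σ[ xs₂ ∈ List ℕ ] (xs₁ ⊆ X × xs₂ ⊆ Y × xs₁ ++ xs₂ ≡ xs)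
  ⊆-++⁻ [] p = [] , _ , [] , p , refl
  ⊆-++⁻ (x ∷ X) (.x ∷ʳ p) with ⊆-++⁻ X p
  ... | xs₁ , xs₂ , p₁ , p₂ , eq = xs₁ , xs₂ , (x ∷ʳ p₁) , p₂ , eq
  ⊆-++⁻ (x ∷ X) (refl ∷ p) with ⊆-++⁻ X p
  ... | xs₁ , xs₂ , p₁ , p₂ , refl = x ∷ xs₁ , xs₂ , (refl ∷ p₁) , p₂ , refl

  ⊆-∷ʳ⁻ : ∀ (xs : List ℕ) {z} ds {t} → (xs ++ [ z ]) ⊆ (ds ++ [ t ]) → ((xs ++ [ z ]) ⊆ ds) ⊎ (z ≡ t × xs ⊆ ds)
  ⊆-∷ʳ⁻ [] [] (refl ∷ []) = inj₂ (refl , [])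
  ⊆-∷ʳ⁻ (x ∷ []) [] (refl ∷ ())
  ⊆-∷ʳ⁻ (x ∷ _ ∷ _) [] (refl ∷ ())
  ⊆-∷ʳ⁻ xs (d ∷ ds) (.d ∷ʳ p) with ⊆-∷ʳ⁻ xs ds p
  ... | inj₁ q = inj₁ (d ∷ʳ q)
  ... | inj₂ (e , q) = inj₂ (e , (d ∷ʳ q))
  ⊆-∷ʳ⁻ [] (d ∷ ds) (refl ∷ p) = inj₁ (refl ∷ minimum ds)
  ⊆-∷ʳ⁻ (x ∷ xs) (d ∷ ds) (refl ∷ p) with ⊆-∷ʳ⁻ xs ds p
  ... | inj₁ q = inj₁ (refl ∷ q)
  ... | inj₂ (e , q) = inj₂ (e , (refl ∷ q))

  ++-≡-++⁻ : ∀ (xs₁ xs₂ D E : List ℕ) → xs₁ ++ xs₂ ≡ D ++ E →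
    (Σ[ m ∈ List ℕ ] (xs₁ ≡ D ++ m × E ≡ m ++ xs₂)) ⊎ (Σ[ m ∈ List ℕ ] (D ≡ xs₁ ++ m × xs₂ ≡ m ++ E))
  ++-≡-++⁻ [] xs₂ D E eq = inj₂ (D , refl , eq)
  ++-≡-++⁻ (x ∷ xs₁) xs₂ [] E eq = inj₁ (x ∷ xs₁ , refl , sym eq)
  ++-≡-++⁻ (x ∷ xs₁) xs₂ (d ∷ D) E eq with List.∷-injective eq
  ... | refl , eq′ with ++-≡-++⁻ xs₁ xs₂ D E eq′
  ...   | inj₁ (m , e₁ , e₂) = inj₁ (m , cong (x ∷_) e₁ , e₂)
  ...   | inj₂ (m , e₁ , e₂) = inj₂ (m , cong (x ∷_) e₁ , e₂)

  split-at-absent : ∀ {N : ℕ} D D′ {R R′} → D ++ N ∷ R ≡ D′ ++ N ∷ R′ → N ∉ D → N ∉ D′ → D ≡ D′ × R ≡ R′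
  split-at-absent [] [] refl _ _ = refl , refl
  split-at-absent [] (d ∷ D′) refl _ N∉D′ = ⊥-elim (N∉D′ (here refl))
  split-at-absent (d ∷ D) [] refl N∉D _ = ⊥-elim (N∉D (here refl))
  split-at-absent (d ∷ D) (d′ ∷ D′) eq N∉D N∉D′ with List.∷-injective eq
  ... | refl , eq′ with split-at-absent D D′ eq′ (N∉D ∘ there) (N∉D′ ∘ there)
  ...   | refl , refl = refl , refl

  applyUpTo-++ : ∀ (f : ℕ → ℕ) m n → applyUpTo f (m + n) ≡ applyUpTo f m ++ applyUpTo (λ u → f (m + u)) n
  applyUpTo-++ f zero n = refl
  applyUpTo-++ f (suc m) n = cong (f 0 ∷_) (applyUpTo-++ (λ u → f (suc u)) m n)

  applyDownFrom-+ : ∀ (f : ℕ → ℕ) j m → applyDownFrom f (j + m) ≡ applyDownFrom (λ u → f (m + u)) j ++ applyDownFrom f m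
  applyDownFrom-+ f zero m = refl
  applyDownFrom-+ f (suc j) m = cong₂ _∷_ (cong f (ℕ.+-comm j m)) (applyDownFrom-+ f j m)

  Unique-resp-↭ : ∀ {xs ys : List ℕ} → xs ↭ ys → Unique xs → Unique ys
  Unique-resp-↭ p = PermutationSetoid.Unique-resp-↭ (setoid ℕ) (↭⇒↭ₛ p)

  Unique-resp-⊆ : ∀ {xs ys : List ℕ} → xs ⊆ ys → Unique ys → Unique xs
  Unique-resp-⊆ [] _ = []
  Unique-resp-⊆ (y ∷ʳ p) (_ ∷ u) = Unique-resp-⊆ p u
  Unique-resp-⊆ (refl ∷ p) (x∉ ∷ u) = All-resp-⊆ p x∉ ∷ Unique-resp-⊆ p u

  Unique-applyUpTo-suc : ∀ n → Unique (applyUpTo suc n)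
  Unique-applyUpTo-suc n = Unique.applyUpTo⁺₁ suc n (λ i<j _ e → ℕ.<-irrefl (ℕ.suc-injective e) i<j)

  ∈-applyUpTo-suc : ∀ {x n} → x ∈ applyUpTo suc n → 0 < x × x ≤ n
  ∈-applyUpTo-suc x∈ with ∈.∈-applyUpTo⁻ suc x∈
  ... | i , i<n , refl = s≤s z≤n , i<n

module Patterns where
  open import Data.Nat using (_+_)
  open ListFacts

  SameComparison : ℕ → ℕ → ℕ → ℕ → Set
  SameComparison x y x′ y′ = (x < x′ ⇔ y < y′) × (x′ < x ⇔ y′ < y)

  both-above : ∀ {x y x′ y′} → x < x′ → y < y′ → SameComparison x y x′ y′
  both-above x<x′ y<y′ = mk⇔ (λ _ → y<y′) (λ _ → x<x′) , mk⇔ (⊥-elim ∘ ℕ.<-asym x<x′) (⊥-elim ∘ ℕ.<-asym y<y′)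

  both-below : ∀ {x y x′ y′} → x′ < x → y′ < y → SameComparison x y x′ y′
  both-below x′<x y′<y = mk⇔ (⊥-elim ∘ ℕ.<-asym x′<x) (⊥-elim ∘ ℕ.<-asym y′<y) , mk⇔ (λ _ → y′<y) (λ _ → x′<x)

  all-below : ∀ {x y xs ys} → length xs ≡ length ys → All (_< x) xs → All (_< y) ys → Pointwise (SameComparison x y) xs ys
  all-below {xs = []} {[]} _ [] [] = []
  all-below {xs = _ ∷ _} {_ ∷ _} eq (x′<x ∷ xs<x) (y′<y ∷ ys<y) = both-below x′<x y′<y ∷ all-below (ℕ.suc-injective eq) xs<x ys<y

  OrderIso-[] : OrderIso [] []
  OrderIso-[] = refl , λ ()

  OrderIso-∷ : ∀ {x y xs ys} → Pointwise (SameComparison x y) xs ys → OrderIso xs ys → OrderIso (x ∷ xs) (y ∷ ys)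
  OrderIso-∷ {x} {y} {xs} {ys} x~y (eq , iso) = cong suc eq , compare
    where
    compare : ∀ i j → (lookup (x ∷ xs) i < lookup (x ∷ xs) j)
                      ⇔ (lookup (y ∷ ys) (Fin.cast (cong suc eq) i) < lookup (y ∷ ys) (Fin.cast (cong suc eq) j))
    compare Fin.zero Fin.zero = mk⇔ (⊥-elim ∘ ℕ.<-irrefl refl) (⊥-elim ∘ ℕ.<-irrefl refl)
    compare Fin.zero (Fin.suc j) = proj₁ (Pointwise.lookup-cast x~y eq j)
    compare (Fin.suc i) Fin.zero = proj₂ (Pointwise.lookup-cast x~y eq i)
    compare (Fin.suc i) (Fin.suc j) = iso i j

  OrderIso-∷⁻ : ∀ {x y xs ys} → OrderIso (x ∷ xs) (y ∷ ys) → Pointwise (SameComparison x y) xs ys × OrderIso xs ys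
  OrderIso-∷⁻ {x} {y} {xs} {ys} (eq , iso) = Pointwise.lookup⁻ (ℕ.suc-injective eq) compare , ℕ.suc-injective eq , λ i j → iso (Fin.suc i) (Fin.suc j)
    where
    compare : ∀ {i j} → toℕ i ≡ toℕ j → SameComparison x y (lookup xs i) (lookup ys j)
    compare {i} i≡j with Fin.toℕ-injective (trans (Fin.toℕ-cast (ℕ.suc-injective eq) i) i≡j)
    ... | refl = iso Fin.zero (Fin.suc i) , iso (Fin.suc i) Fin.zero

  Contains-⊆ : ∀ {π π′ σ} → π ⊆ π′ → Contains π σ → Contains π′ σ
  Contains-⊆ π⊆π′ (xs , xs⊆π , iso) = xs , ⊆-trans xs⊆π π⊆π′ , iso

  private
    length≡3 : ∀ {xs : List ℕ} → length xs ≡ 3 → ∃₂ λ x y → Σ[ z ∈ ℕ ] xs ≡ x ∷ y ∷ z ∷ []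
    length≡3 {x ∷ y ∷ z ∷ []} refl = x , y , z , refl

  Contains-123⁻ : ∀ {π} → Contains π p123 → ∃₂ λ x y → Σ[ z ∈ ℕ ] (x ∷ y ∷ z ∷ []) ⊆ π × x < y × y < z
  Contains-123⁻ (xs , xs⊆π , eq , iso) with length≡3 {xs} eq
  ... | x , y , z , refl =
    x , y , z , xs⊆π , Equivalence.from (iso Fin.zero (Fin.suc Fin.zero)) (s≤s (s≤s z≤n))
                     , Equivalence.from (iso (Fin.suc Fin.zero) (Fin.suc (Fin.suc Fin.zero))) (s≤s (s≤s (s≤s z≤n)))

  Contains-132⁻ : ∀ {π} → Contains π p132 → ∃₂ λ x y → Σ[ z ∈ ℕ ] (x ∷ y ∷ z ∷ []) ⊆ π × x < z × z < y
  Contains-132⁻ (xs , xs⊆π , eq , iso) with length≡3 {xs} eq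
  ... | x , y , z , refl =
    x , y , z , xs⊆π , Equivalence.from (iso Fin.zero (Fin.suc (Fin.suc Fin.zero))) (s≤s (s≤s z≤n))
                     , Equivalence.from (iso (Fin.suc (Fin.suc Fin.zero)) (Fin.suc Fin.zero)) (s≤s (s≤s (s≤s z≤n)))

  Contains-123⁺ : ∀ {π x y z} → (x ∷ y ∷ z ∷ []) ⊆ π → x < y → y < z → Contains π p123
  Contains-123⁺ xyz⊆π x<y y<z = _ , xyz⊆π ,
    OrderIso-∷ (both-above x<y (s≤s (s≤s z≤n)) ∷ both-above (ℕ.<-trans x<y y<z) (s≤s (s≤s z≤n)) ∷ [])
      (OrderIso-∷ (both-above y<z (s≤s (s≤s (s≤s z≤n))) ∷ []) (OrderIso-∷ [] OrderIso-[]))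

  Contains-132⁺ : ∀ {π x y z} → (x ∷ y ∷ z ∷ []) ⊆ π → x < z → z < y → Contains π p132
  Contains-132⁺ xyz⊆π x<z z<y = _ , xyz⊆π ,
    OrderIso-∷ (both-above (ℕ.<-trans x<z z<y) (s≤s (s≤s z≤n)) ∷ both-above x<z (s≤s (s≤s z≤n)) ∷ [])
      (OrderIso-∷ (both-below z<y (s≤s (s≤s (s≤s z≤n))) ∷ []) (OrderIso-∷ [] OrderIso-[]))

  γ-middle : ℕ → List ℕ
  γ-middle b = map (_+_ 2) (downFrom b)

  length-γ-middle : ∀ b → length (γ-middle b) ≡ b
  length-γ-middle b = trans (List.length-map (_+_ 2) (downFrom b)) (List.length-downFrom b)

  γ-middle-below : ∀ b → All (_< 2 + b) (γ-middle b)
  γ-middle-below b = All.map⁺ (All.tabulate (λ u∈ → s≤s (s≤s (∈.∈-downFrom⁻ u∈))))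

  private
    split-at : ∀ b (rest : List ℕ) → length rest ≡ b + 2 → Σ[ D ∈ List ℕ ] ∃₂ λ B C → rest ≡ D ++ B ∷ C ∷ [] × length D ≡ b
    split-at zero (B ∷ C ∷ []) refl = [] , B , C , refl , refl
    split-at (suc b) (r ∷ rest) eq with split-at b rest (ℕ.suc-injective eq)
    ... | D , B , C , refl , refl = r ∷ D , B , C , refl , refl

  below-before : ∀ D G {B C B′ C′} → length D ≡ length G →
    OrderIso (D ++ B ∷ C ∷ []) (G ++ B′ ∷ C′ ∷ []) → All (_< B′) G → All (_< B) D
  below-before [] [] _ _ [] = []
  below-before (d ∷ D) (g ∷ G) eq iso (g<B′ ∷ G<B′) with OrderIso-∷⁻ iso
  ... | d~g , iso′ with Pointwise-drop D G (ℕ.suc-injective eq) d~g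
  ...   | d~g,B~B′ ∷ _ = Equivalence.from (proj₁ d~g,B~B′) g<B′ ∷ below-before D G (ℕ.suc-injective eq) iso′ G<B′

  Contains-γ⁻ : ∀ b {π} → Contains π (gamma b) →
    Σ[ A ∈ ℕ ] Σ[ D ∈ List ℕ ] ∃₂ λ B C → (A ∷ D ++ B ∷ C ∷ []) ⊆ π × length D ≡ b × B < A × All (_< B) D
  Contains-γ⁻ b ([] , _ , () , _)
  Contains-γ⁻ b (A ∷ rest , sub , iso) with OrderIso-∷⁻ iso
  ... | A~ , iso′ with split-at b rest (trans (proj₁ iso′) (trans (List.length-++ (γ-middle b)) (cong (_+ 2) (length-γ-middle b))))
  ... | D , B , C , refl , refl with Pointwise-drop D (γ-middle (length D)) (sym (length-γ-middle _)) A~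
  ...   | B~ ∷ _ = A , D , B , C , sub , refl , Equivalence.from (proj₂ B~) (ℕ.n<1+n _)
                   , below-before D (γ-middle (length D)) (sym (length-γ-middle _)) iso′ (γ-middle-below _)

module BlockPermutations where
  open import Data.Nat using (_+_)
  open ListFacts
  open Patterns

  weight : List ℕ → ℕ
  weight [] = 0
  weight (k ∷ ks) = suc k + weight ks

  run : ℕ → ℕ → List ℕ
  run s k = applyDownFrom (λ u → suc (s + u)) k

  module _ (b s B C : ℕ) (run<B : ∀ u → u < b → suc (s + u) < B) (C<run : C < suc s) (C<B : C < B) where
    private
      run-below : ∀ m j → j ≤ m → Pointwise (SameComparison (suc (s + m)) (2 + m)) (run s j) (γ-middle j)
      run-below m zero _ = []
      run-below m (suc j) (s≤s j≤m) = both-below (s≤s (ℕ.+-monoʳ-< s (s≤s j≤m))) (s≤s (s≤s (s≤s j≤m))) ∷ run-below m j (ℕ.m≤n⇒m≤1+n j≤m)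

      tail-iso : ∀ m → m ≤ b → OrderIso (run s m ++ B ∷ C ∷ []) (γ-middle m ++ (2 + b) ∷ 1 ∷ [])
      tail-iso zero _ = OrderIso-∷ (both-below C<B (s≤s (s≤s z≤n)) ∷ []) (OrderIso-∷ [] OrderIso-[])
      tail-iso (suc m) m<b = OrderIso-∷
        (Pointwise.++⁺ (run-below m m ℕ.≤-refl)
          (both-above (run<B m m<b) (s≤s (s≤s m<b)) ∷ both-below (ℕ.<-≤-trans C<run (s≤s (ℕ.m≤m+n s m))) (s≤s (s≤s z≤n)) ∷ []))
        (tail-iso m (ℕ.<⇒≤ m<b))

    Contains-γ⁺ : ∀ {π} A → (A ∷ run s b ++ B ∷ C ∷ []) ⊆ π → All (_< A) (run s b ++ B ∷ C ∷ []) → Contains π (gamma b)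
    Contains-γ⁺ A sub rest<A = _ , sub , OrderIso-∷ (all-below (proj₁ (tail-iso b ℕ.≤-refl)) rest<A γ-rest-below) (tail-iso b ℕ.≤-refl)
      where
      γ-rest-below : All (_< 3 + b) (γ-middle b ++ (2 + b) ∷ 1 ∷ [])
      γ-rest-below = All.++⁺ (All.map (ℕ.m<n⇒m<1+n) (γ-middle-below b)) (ℕ.n<1+n _ ∷ s≤s (s≤s z≤n) ∷ [])

  top : ℕ → ℕ → ℕ
  top s k = suc (s + k)

  block : ℕ → ℕ → List ℕ
  block s k = run s k ++ [ top s k ]

  -- blocks [k₁, …, kₘ] is made of blocks of kᵢ + 1 consecutive values, the first block holding the largest ones.
  blocks : List ℕ → List ℕ
  blocks [] = []
  blocks (k ∷ ks) = block (weight ks) k ++ blocks ks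

  length-run : ∀ s k → length (run s k) ≡ k
  length-run s k = List.length-applyDownFrom _ k

  length-blocks : ∀ ks → length (blocks ks) ≡ weight ks
  length-blocks [] = refl
  length-blocks (k ∷ ks) = begin
    length (block s k ++ blocks ks)                 ≡⟨ List.length-++ (block s k) ⟩
    length (run s k ++ [ top s k ]) + length (blocks ks) ≡⟨ cong₂ _+_ (List.length-++ (run s k)) (length-blocks ks) ⟩
    (length (run s k) + 1) + weight ks               ≡⟨ cong (λ x → (x + 1) + weight ks) (length-run s k) ⟩
    (k + 1) + weight ks                              ≡⟨ cong (_+ weight ks) (ℕ.+-comm k 1) ⟩
    suc k + weight ks ∎
    where
    open ≡-Reasoning
    s = weight ks

  run-bounds : ∀ s k → All (λ v → s < v × v < top s k) (run s k)
  run-bounds s zero = []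
  run-bounds s (suc k) = (s≤s (ℕ.m≤m+n s k) , s≤s (ℕ.+-monoʳ-< s (ℕ.n<1+n k)))
    ∷ All.map (λ { (l , u) → l , ℕ.<-trans u (s≤s (ℕ.+-monoʳ-< s (ℕ.n<1+n k))) }) (run-bounds s k)

  run-decreasing : ∀ s k → AllPairs _>_ (run s k)
  run-decreasing s k = AllPairs.applyDownFrom⁺₁ _ k (λ j<i _ → s≤s (ℕ.+-monoʳ-< s j<i))

  block-bounds : ∀ s k → All (λ v → s < v × v ≤ top s k) (block s k)
  block-bounds s k = All.++⁺ (All.map (λ { (l , u) → l , ℕ.<⇒≤ u }) (run-bounds s k)) ((s≤s (ℕ.m≤m+n s k) , ℕ.≤-refl) ∷ [])

  top-weight : ∀ k ks → top (weight ks) k ≡ weight (k ∷ ks)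
  top-weight k ks = cong suc (ℕ.+-comm (weight ks) k)

  blocks-bounds : ∀ ks → All (λ v → 0 < v × v ≤ weight ks) (blocks ks)
  blocks-bounds [] = []
  blocks-bounds (k ∷ ks) = All.++⁺
    (All.map (λ { (l , u) → ℕ.≤-trans (s≤s z≤n) l , ℕ.≤-trans u (ℕ.≤-reflexive (top-weight k ks)) }) (block-bounds (weight ks) k))
    (All.map (λ { (l , u) → l , ℕ.≤-trans u (ℕ.≤-trans (ℕ.m≤n+m (weight ks) k) (ℕ.n≤1+n _)) }) (blocks-bounds ks))

  block-above-blocks : ∀ k ks {u v} → u ∈ block (weight ks) k → v ∈ blocks ks → v < u
  block-above-blocks k ks u∈ v∈ = ℕ.≤-<-trans (proj₂ (All.lookup (blocks-bounds ks) v∈)) (proj₁ (All.lookup (block-bounds (weight ks) k) u∈))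

  block-↭ : ∀ s k → block s k ↭ applyUpTo (λ u → suc (s + u)) (suc k)
  block-↭ s k = ↭-trans (↭.++⁺ʳ [ top s k ] (↭-trans (↭-reflexive (sym (List.reverse-applyUpTo _ k))) (↭.↭-reverse (applyUpTo _ k))))
                        (↭-reflexive (List.applyUpTo-∷ʳ (λ u → suc (s + u)) k))

  blocks-↭ : ∀ ks → blocks ks ↭ applyUpTo suc (weight ks)
  blocks-↭ [] = ↭-refl
  blocks-↭ (k ∷ ks) = ↭-trans (↭.++⁺ (block-↭ s k) (blocks-↭ ks))
    (↭-trans (↭.++-comm (applyUpTo (λ u → suc (s + u)) (suc k)) (applyUpTo suc s))
    (↭-reflexive (trans (sym (applyUpTo-++ suc s (suc k))) (cong (applyUpTo suc) (ℕ.+-comm s (suc k))))))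
    where
    s = weight ks

  blocks-∷ : ∀ k ks → blocks (k ∷ ks) ≡ run (weight ks) k ++ weight (k ∷ ks) ∷ blocks ks
  blocks-∷ k ks = trans (List.++-assoc (run (weight ks) k) [ top (weight ks) k ] (blocks ks))
                        (cong (λ t → run (weight ks) k ++ t ∷ blocks ks) (top-weight k ks))

  private
    weight∉run : ∀ k ks → weight (k ∷ ks) ∉ run (weight ks) k
    weight∉run k ks w∈ = ℕ.<-irrefl (sym (top-weight k ks)) (proj₂ (All.lookup (run-bounds (weight ks) k) w∈))

  blocks-injective : ∀ ks ks′ → blocks ks ≡ blocks ks′ → ks ≡ ks′
  blocks-injective [] [] _ = refl
  blocks-injective [] (k ∷ ks) eq with trans (cong length eq) (length-blocks (k ∷ ks))
  ... | ()
  blocks-injective (k ∷ ks) [] eq with trans (sym (length-blocks (k ∷ ks))) (cong length eq)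
  ... | ()
  blocks-injective (k ∷ ks) (k′ ∷ ks′) eq
    with trans (sym (length-blocks (k ∷ ks))) (trans (cong length eq) (length-blocks (k′ ∷ ks′)))
  ... | same-weight
    with split-at-absent (run (weight ks) k) (run (weight ks′) k′)
           (trans (sym (blocks-∷ k ks)) (trans eq (trans (blocks-∷ k′ ks′) (cong (λ N → run (weight ks′) k′ ++ N ∷ blocks ks′) (sym same-weight)))))
           (weight∉run k ks) (subst (_∉ run (weight ks′) k′) (sym same-weight) (weight∉run k′ ks′))
  ... | same-run , same-rest
    with trans (sym (length-run (weight ks) k)) (trans (cong length same-run) (length-run (weight ks′) k′))
  ... | refl = cong (k ∷_) (blocks-injective ks ks′ same-rest)

  decreasing-pair : ∀ {x y ds} → (x ∷ y ∷ []) ⊆ ds → AllPairs _>_ ds → y < x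
  decreasing-pair (d ∷ʳ p) (_ ∷ ds↓) = decreasing-pair p ds↓
  decreasing-pair (refl ∷ p) (x>ds ∷ _) = All.lookup x>ds (to∈ p)

  ascent-ends-at-top : ∀ {x y ds t} → AllPairs _>_ ds → (x ∷ y ∷ []) ⊆ (ds ++ [ t ]) → x < y → y ≡ t
  ascent-ends-at-top {x} {ds = ds} ds↓ p x<y with ⊆-∷ʳ⁻ (x ∷ []) ds p
  ... | inj₁ q = ⊥-elim (ℕ.<-asym x<y (decreasing-pair q ds↓))
  ... | inj₂ (y≡t , _) = y≡t

  NoTwoLargerAfter : List ℕ → Set
  NoTwoLargerAfter π = ∀ {x y z} → (x ∷ y ∷ z ∷ []) ⊆ π → x < y → x < z → ⊥

  NoTwoLargerAfter-block : ∀ {ds} t → AllPairs _>_ ds → NoTwoLargerAfter (ds ++ [ t ])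
  NoTwoLargerAfter-block {ds} t ds↓ {x} {y} {z} p x<y x<z with ⊆-∷ʳ⁻ (x ∷ y ∷ []) ds p
  ... | inj₁ q = ℕ.<-asym x<y (decreasing-pair (⊆-trans (refl ∷ refl ∷ (z ∷ʳ [])) q) ds↓)
  ... | inj₂ (_ , q) = ℕ.<-asym x<y (decreasing-pair q ds↓)

  NoTwoLargerAfter-++ : ∀ X {Y} → NoTwoLargerAfter X → NoTwoLargerAfter Y → (∀ {u v} → u ∈ X → v ∈ Y → v < u) → NoTwoLargerAfter (X ++ Y)
  NoTwoLargerAfter-++ X ntX ntY Y<X p x<y x<z with ⊆-++⁻ X p
  ... | [] , _ , _ , p₂ , refl = ntY p₂ x<y x<z
  ... | _ ∷ [] , _ ∷ _ , p₁ , p₂ , refl = ℕ.<-asym x<y (Y<X (to∈ p₁) (to∈ p₂))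
  ... | _ ∷ _ ∷ [] , _ ∷ [] , p₁ , p₂ , refl = ℕ.<-asym x<z (Y<X (to∈ p₁) (to∈ p₂))
  ... | _ ∷ _ ∷ _ ∷ [] , [] , p₁ , p₂ , refl = ntX p₁ x<y x<z

  NoTwoLargerAfter-blocks : ∀ ks → NoTwoLargerAfter (blocks ks)
  NoTwoLargerAfter-blocks [] ()
  NoTwoLargerAfter-blocks (k ∷ ks) = NoTwoLargerAfter-++ (block (weight ks) k)
    (NoTwoLargerAfter-block (top (weight ks) k) (run-decreasing (weight ks) k)) (NoTwoLargerAfter-blocks ks) (block-above-blocks k ks)

  length-block : ∀ s k → length (block s k) ≡ suc k
  length-block s k = trans (List.length-++ (run s k)) (trans (cong (_+ 1) (length-run s k)) (ℕ.+-comm k 1))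

  avoiders-NoTwoLargerAfter : ∀ {π} → Unique π → ¬ Contains π p123 → ¬ Contains π p132 → NoTwoLargerAfter π
  avoiders-NoTwoLargerAfter u ¬123 ¬132 {x} {y} {z} p x<y x<z with ℕ.<-cmp y z
  ... | tri< y<z _ _ = ¬123 (Contains-123⁺ p x<y y<z)
  ... | tri> _ _ z<y = ¬132 (Contains-132⁺ p x<z z<y)
  ... | tri≈ _ refl _ with Unique-resp-⊆ (∷ˡ⁻ p) u
  ...   | (y≢y ∷ _) ∷ _ = y≢y refl

  Dominant : List ℕ → List ℕ → Set
  Dominant [] R = ⊤
  Dominant (x ∷ L) R = All (_< x) (L ++ R) × Dominant L R

  before-maximum-dominant : ∀ N L R → NoTwoLargerAfter (L ++ N ∷ R) → Unique (L ++ N ∷ R) → All (_< N) (L ++ R) → Dominant L R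
  before-maximum-dominant N [] R _ _ _ = tt
  before-maximum-dominant N (x ∷ L) R no-two (x∉ ∷ u) (x<N ∷ L++R<N) =
    All.tabulate later<x , before-maximum-dominant N L R (no-two ∘ (x ∷ʳ_)) u L++R<N
    where
    later<x : ∀ {y} → y ∈ L ++ R → y < x
    later<x {y} y∈ with ℕ.<-cmp y x | ∈.∈-++⁻ L y∈
    ... | tri< y<x _ _ | _ = y<x
    ... | tri≈ _ refl _ | inj₁ y∈L = ⊥-elim (All.lookup x∉ (∈.∈-++⁺ˡ y∈L) refl)
    ... | tri≈ _ refl _ | inj₂ y∈R = ⊥-elim (All.lookup x∉ (∈.∈-++⁺ʳ L (there y∈R)) refl)
    ... | tri> _ _ x<y | inj₁ y∈L = ⊥-elim (no-two (refl ∷ ++⁺ (from∈ y∈L) (refl ∷ minimum R)) x<y x<N)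
    ... | tri> _ _ x<y | inj₂ y∈R = ⊥-elim (no-two (refl ∷ ++⁺ˡ L (refl ∷ from∈ y∈R)) x<N x<y)

  dominant-prefix-is-run : ∀ L R m → L ++ R ↭ applyUpTo suc m → Dominant L R →
    Σ[ s ∈ ℕ ] (L ≡ run s (length L) × R ↭ applyUpTo suc s × length L + s ≡ m)
  dominant-prefix-is-run [] R m p _ = m , refl , p , refl
  dominant-prefix-is-run (x ∷ L) R zero p _ = ⊥-elim (↭.¬x∷xs↭[] p)
  dominant-prefix-is-run (x ∷ L) R (suc m) p (later<x , dominant) = prepend (dominant-prefix-is-run L R m rest dominant)
    where
    x≡max : x ≡ suc m
    x≡max with ↭.∈-resp-↭ (↭-sym p) (∈.∈-applyUpTo⁺ suc (ℕ.n<1+n m))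
    ... | here eq = sym eq
    ... | there max∈ = ⊥-elim (ℕ.<-irrefl refl (ℕ.<-≤-trans (All.lookup later<x max∈) (proj₂ (∈-applyUpTo-suc (↭.∈-resp-↭ p (here refl))))))
    rest : L ++ R ↭ applyUpTo suc m
    rest = subst (L ++ R ↭_) (List.++-identityʳ _)
      (↭.drop-mid [] (applyUpTo suc m)
        (subst (x ∷ (L ++ R) ↭_) (trans (sym (List.applyUpTo-∷ʳ suc m)) (cong (λ v → applyUpTo suc m ++ [ v ]) (sym x≡max))) p))
    prepend : Σ[ s ∈ ℕ ] (L ≡ run s (length L) × R ↭ applyUpTo suc s × length L + s ≡ m) →
              Σ[ s ∈ ℕ ] (x ∷ L ≡ run s (suc (length L)) × R ↭ applyUpTo suc s × suc (length L + s) ≡ suc m)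
    prepend (s , L≡run , R↭ , size) = s , cong₂ _∷_ (trans x≡max (cong suc (trans (sym size) (ℕ.+-comm (length L) s)))) L≡run , R↭ , cong suc size

  peel-block : ∀ m π → π ↭ applyUpTo suc (suc m) → ¬ Contains π p123 → ¬ Contains π p132 →
    Σ[ k ∈ ℕ ] Σ[ s ∈ ℕ ] Σ[ R ∈ List ℕ ] (π ≡ run s k ++ suc m ∷ R × R ↭ applyUpTo suc s × k + s ≡ m)
  peel-block m π p ¬123 ¬132 with ∈.∈-∃++ (↭.∈-resp-↭ (↭-sym p) (∈.∈-applyUpTo⁺ suc (ℕ.n<1+n m)))
  ... | L , R , refl with dominant-prefix-is-run L R m L++R↭ (before-maximum-dominant N L R no-two unique L++R<N)
    where
    N = suc m
    unique : Unique (L ++ N ∷ R)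
    unique = Unique-resp-↭ (↭-sym p) (Unique-applyUpTo-suc (suc m))
    no-two : NoTwoLargerAfter (L ++ N ∷ R)
    no-two = avoiders-NoTwoLargerAfter unique ¬123 ¬132
    N∉ : All (N ≢_) (L ++ R)
    N∉ with Unique-resp-↭ (↭.shift N L R) unique
    ... | N∉ ∷ _ = N∉
    L++R<N : All (_< N) (L ++ R)
    L++R<N = All.tabulate λ {v} v∈ → ℕ.≤∧≢⇒< (proj₂ (∈-applyUpTo-suc (↭.∈-resp-↭ p (↭.∈-resp-↭ (↭-sym (↭.shift N L R)) (there v∈))))) (λ v≡N → All.lookup N∉ v∈ (sym v≡N))
    L++R↭ : L ++ R ↭ applyUpTo suc m
    L++R↭ = subst (L ++ R ↭_) (List.++-identityʳ _)
      (↭.drop-mid L (applyUpTo suc m) (subst (L ++ N ∷ R ↭_) (sym (List.applyUpTo-∷ʳ suc m)) p))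
  ... | s , L≡run , R↭ , size = length L , s , R , cong (_++ suc m ∷ R) L≡run , R↭ , size

module Avoidance (c : ℕ) where
  open import Data.Nat using (_+_)
  open ListFacts
  open BlockPermutations

  b : ℕ
  b = 2 + c

  InitBelow : List ℕ → Set
  InitBelow [] = ⊤
  InitBelow (k ∷ []) = ⊤
  InitBelow (k ∷ k′ ∷ ks) = k < b × InitBelow (k′ ∷ ks)

  Admissible : List ℕ → Set
  Admissible [] = ⊤
  Admissible (k ∷ ks) = InitBelow ks

  InitBelow-tail : ∀ k ks → InitBelow (k ∷ ks) → InitBelow ks
  InitBelow-tail k [] _ = tt
  InitBelow-tail k (k′ ∷ ks) (_ , below) = below

  InitBelow⇒Admissible : ∀ ks → InitBelow ks → Admissible ks
  InitBelow⇒Admissible [] _ = tt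
  InitBelow⇒Admissible (k ∷ ks) = InitBelow-tail k ks

  private
    ascent-crosses : ∀ k ks {d B} → d ∈ block (weight ks) k → B ∈ blocks ks → d < B → ⊥
    ascent-crosses k ks d∈ B∈ d<B = ℕ.<-asym d<B (block-above-blocks k ks d∈ B∈)

    run-descends : ∀ s k {d B C} → (d ∷ B ∷ C ∷ []) ⊆ block s k → d < B → ⊥
    run-descends s k {d} {B} p d<B with ⊆-∷ʳ⁻ (d ∷ B ∷ []) (run s k) p
    ... | inj₁ q = ℕ.<-asym d<B (decreasing-pair (⊆-trans (refl ∷ refl ∷ (_ ∷ʳ [])) q) (run-decreasing s k))
    ... | inj₂ (_ , q) = ℕ.<-asym d<B (decreasing-pair q (run-decreasing s k))

  long-ascent-in-tail : ∀ ks → InitBelow ks → ∀ d D {B C} → (d ∷ D ++ B ∷ C ∷ []) ⊆ blocks ks →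
                        All (_< B) (d ∷ D) → b ≤ suc (length D) → ⊥
  long-ascent-in-tail (k ∷ ks) below d D {B} {C} p (d<B ∷ D<B) long with ⊆-++⁻ (block (weight ks) k) p
  ... | [] , _ , _ , p₂ , refl = long-ascent-in-tail ks (InitBelow-tail k ks below) d D p₂ (d<B ∷ D<B) long
  ... | _ ∷ xs₁ , xs₂ , p₁ , p₂ , eq with List.∷-injective eq
  ...   | refl , eq′ with ++-≡-++⁻ xs₁ xs₂ D (B ∷ C ∷ []) eq′
  ...     | inj₂ (m , refl , refl) = ascent-crosses k ks (to∈ p₁) (Sublist.lookup p₂ (∈.∈-++⁺ʳ m (here refl))) d<B
  ...     | inj₁ ([] , refl , refl) = ascent-crosses k ks (to∈ p₁) (to∈ p₂) d<B
  ...     | inj₁ (.B ∷ [] , refl , refl) with ks | below | p₂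
  ...       | k′ ∷ ks′ | k<b , _ | _ = ℕ.<-irrefl refl (ℕ.<-≤-trans k<b (ℕ.≤-trans long (ℕ.≤-pred fits)))
    where
    fits : suc (suc (length D)) ≤ suc k
    fits = subst₂ _≤_ (cong suc (trans (List.length-++ D) (ℕ.+-comm (length D) 1))) (length-block (weight (k′ ∷ ks′)) k) (length-mono-≤ p₁)
  long-ascent-in-tail (k ∷ ks) below d D {B} {C} p (d<B ∷ D<B) long | _ ∷ _ , _ , p₁ , p₂ , eq | refl , eq′ | inj₁ (.B ∷ .C ∷ [] , refl , refl) =
    run-descends (weight ks) k (⊆-trans (refl ∷ ++⁺ˡ D (refl ∷ refl ∷ [])) p₁) d<B

  γ-shape-impossible : ∀ ks → Admissible ks → ∀ A d D {B C} → (A ∷ d ∷ D ++ B ∷ C ∷ []) ⊆ blocks ks →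
                       B < A → All (_< B) (d ∷ D) → b ≤ suc (length D) → ⊥
  γ-shape-impossible (k ∷ ks) admissible A d D {B} {C} p B<A (d<B ∷ D<B) long with ⊆-++⁻ (block (weight ks) k) p
  ... | [] , _ , _ , p₂ , refl = γ-shape-impossible ks (InitBelow⇒Admissible ks admissible) A d D p₂ B<A (d<B ∷ D<B) long
  ... | _ ∷ [] , _ , _ , p₂ , refl = long-ascent-in-tail ks admissible d D p₂ (d<B ∷ D<B) long
  ... | _ ∷ _ ∷ xs₁ , xs₂ , p₁ , p₂ , eq with List.∷-injective eq
  ...   | refl , eq′ with List.∷-injective eq′
  ...     | refl , eq″ with ++-≡-++⁻ xs₁ xs₂ D (B ∷ C ∷ []) eq″
  ...       | inj₂ (m , refl , refl) = ascent-crosses k ks (to∈ (∷ˡ⁻ p₁)) (Sublist.lookup p₂ (∈.∈-++⁺ʳ m (here refl))) d<B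
  ...       | inj₁ ([] , refl , refl) = ascent-crosses k ks (to∈ (∷ˡ⁻ p₁)) (to∈ p₂) d<B
  ...       | inj₁ (B′ ∷ m , refl , e) with List.∷-injectiveˡ e
  ...         | refl = ℕ.<-irrefl refl (ℕ.<-≤-trans B<A (subst (A ≤_) (sym B≡top) (proj₂ (All.lookup (block-bounds (weight ks) k) (to∈ p₁)))))
    where
    B≡top : B ≡ top (weight ks) k
    B≡top = ascent-ends-at-top (run-decreasing (weight ks) k) (⊆-trans (A ∷ʳ (refl ∷ ++⁺ˡ D (refl ∷ minimum m))) p₁) d<B

module Characterisation (c : ℕ) where
  open import Data.Nat using (_+_)
  open ListFacts
  open Patterns
  open BlockPermutations
  open Avoidance c

  long-block-contains-γ : ∀ N k k′ ks → b ≤ k → All (_< N) (blocks (k ∷ k′ ∷ ks)) → Contains (N ∷ blocks (k ∷ k′ ∷ ks)) (gamma b)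
  long-block-contains-γ N k k′ ks b≤k N>blocks with ℕ.m≤n⇒∃[o]m+o≡n b≤k
  ... | j , refl = Contains-γ⁺ b s B C run<B C<run C<B N (refl ∷ γ-shape) (All-resp-⊆ γ-shape N>blocks)
    where
    s = weight (k′ ∷ ks)
    B = top s (b + j)
    C = top (weight ks) k′
    run<B : ∀ u → u < b → suc (s + u) < B
    run<B u u<b = s≤s (ℕ.+-monoʳ-< s (ℕ.<-≤-trans u<b (ℕ.m≤m+n b j)))
    C<run : C < suc s
    C<run = s≤s (ℕ.≤-reflexive (top-weight k′ ks))
    C<B : C < B
    C<B = s≤s (ℕ.≤-trans (ℕ.≤-reflexive (top-weight k′ ks)) (ℕ.m≤m+n s (b + j)))
    short⊆long : run s b ⊆ run s (b + j)
    short⊆long = subst (run s b ⊆_) (sym (trans (cong (run s) (ℕ.+-comm b j)) (applyDownFrom-+ _ j b))) (++⁺ˡ _ ⊆-refl)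
    C∈ : C ∈ block (weight ks) k′ ++ blocks ks
    C∈ = ∈.∈-++⁺ˡ (∈.∈-++⁺ʳ (run (weight ks) k′) (here refl))
    γ-shape : run s b ++ B ∷ C ∷ [] ⊆ blocks (b + j ∷ k′ ∷ ks)
    γ-shape = subst (_⊆ blocks (b + j ∷ k′ ∷ ks)) (List.++-assoc (run s b) [ B ] [ C ]) (++⁺ (++⁺ short⊆long ⊆-refl) (from∈ C∈))

  extendByZero-admissible : ∀ N ks → Admissible ks → All (_< N) (blocks ks) → ¬ Contains (N ∷ blocks ks) (gamma b) → InitBelow ks
  extendByZero-admissible N [] _ _ _ = tt
  extendByZero-admissible N (k ∷ []) _ _ _ = tt
  extendByZero-admissible N (k ∷ k′ ∷ ks) admissible N>blocks ¬γ with k ℕ.<? b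
  ... | yes k<b = k<b , admissible
  ... | no k≮b = ⊥-elim (¬γ (long-block-contains-γ N k k′ ks (ℕ.≮⇒≥ k≮b) N>blocks))

  AvoidersAre : ℕ → Set
  AvoidersAre n = ∀ π → π ↭ applyUpTo suc n → ¬ Contains π p132 → ¬ Contains π p123 → ¬ Contains π (gamma b) →
                  Σ[ ks ∈ List ℕ ] (Admissible ks × weight ks ≡ n × blocks ks ≡ π)

  avoider-is-blocks : ∀ n → AvoidersAre n
  avoider-is-blocks = <-rec AvoidersAre step
    where
    step : ∀ n → (∀ {s} → s < n → AvoidersAre s) → AvoidersAre n
    step zero _ π p _ _ _ = [] , tt , refl , sym (↭.↭-empty-inv p)
    step (suc m) smaller π p ¬132 ¬123 ¬γ with peel-block m π p ¬123 ¬132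
    ... | k , s , R , refl , R↭ , size
      with smaller (s≤s (ℕ.≤-trans (ℕ.m≤n+m s k) (ℕ.≤-reflexive size))) R R↭ (¬132 ∘ Contains-⊆ R⊆π) (¬123 ∘ Contains-⊆ R⊆π) (¬γ ∘ Contains-⊆ R⊆π)
      where
      R⊆π : R ⊆ run s k ++ suc m ∷ R
      R⊆π = ++⁺ˡ (run s k) (suc m ∷ʳ ⊆-refl)
    ...   | ks , admissible , refl , refl =
      k ∷ ks , extendByZero-admissible (suc m) ks admissible below (¬γ ∘ Contains-⊆ (++⁺ˡ (run (weight ks) k) ⊆-refl))
             , cong suc size , trans (blocks-∷ k ks) (cong (λ N → run (weight ks) k ++ N ∷ blocks ks) (cong suc size))
      where
      below : All (_< suc m) (blocks ks)
      below = All.map (λ { (_ , v≤) → s≤s (ℕ.≤-trans v≤ (ℕ.≤-trans (ℕ.m≤n+m (weight ks) k) (ℕ.≤-reflexive size))) }) (blocks-bounds ks)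

module TaggedUnion (T : ℕ → List ℕ → List ℕ)
                   (T-injective : ∀ {k xs ys} → T k xs ≡ T k ys → xs ≡ ys)
                   (T-tag-injective : ∀ {k k′ xs ys} → T k xs ≡ T k′ ys → k ≡ k′) where
  open import Data.Nat using (_+_)

  ⋃ : List ℕ → (ℕ → List (List ℕ)) → List (List ℕ)
  ⋃ ks F = concatMap (λ k → map (T k) (F k)) ks

  ∈-⋃⁻ : ∀ ks F {v} → v ∈ ⋃ ks F → ∃₂ λ k xs → k ∈ ks × xs ∈ F k × v ≡ T k xs
  ∈-⋃⁻ (k ∷ ks) F v∈ with ∈.∈-++⁻ (map (T k) (F k)) v∈
  ... | inj₁ v∈F with ∈.∈-map⁻ (T k) v∈F
  ...   | xs , xs∈ , refl = k , xs , here refl , xs∈ , refl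
  ∈-⋃⁻ (k ∷ ks) F v∈ | inj₂ v∈⋃ with ∈-⋃⁻ ks F v∈⋃
  ...   | k′ , xs , k′∈ , xs∈ , refl = k′ , xs , there k′∈ , xs∈ , refl

  ∈-⋃⁺ : ∀ ks F {k xs} → k ∈ ks → xs ∈ F k → T k xs ∈ ⋃ ks F
  ∈-⋃⁺ (k ∷ ks) F (here refl) xs∈ = ∈.∈-++⁺ˡ (∈.∈-map⁺ (T k) xs∈)
  ∈-⋃⁺ (k′ ∷ ks) F (there k∈) xs∈ = ∈.∈-++⁺ʳ (map (T k′) (F k′)) (∈-⋃⁺ ks F k∈ xs∈)

  ⋃-unique : ∀ ks F → Unique ks → (∀ k → Unique (F k)) → Unique (⋃ ks F)
  ⋃-unique [] F _ _ = []
  ⋃-unique (k ∷ ks) F (k∉ks ∷ ks-unique) F-unique =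
    Unique.++⁺ (Unique.map⁺ T-injective (F-unique k)) (⋃-unique ks F ks-unique F-unique) disjoint
    where
    disjoint : ∀ {v} → ¬ (v ∈ map (T k) (F k) × v ∈ ⋃ ks F)
    disjoint (v∈F , v∈⋃) with ∈.∈-map⁻ (T k) v∈F | ∈-⋃⁻ ks F v∈⋃
    ... | xs , _ , refl | k′ , ys , k′∈ , _ , eq = All.lookup k∉ks k′∈ (T-tag-injective eq)

  length-⋃ : ∀ ks F → length (⋃ ks F) ≡ sum (map (length ∘ F) ks)
  length-⋃ [] F = refl
  length-⋃ (k ∷ ks) F = trans (List.length-++ (map (T k) (F k))) (cong₂ _+_ (List.length-map (T k) (F k)) (length-⋃ ks F))

module Prepend = TaggedUnion _∷_ (λ eq → List.∷-injectiveʳ eq) (λ eq → List.∷-injectiveˡ eq)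
module Append = TaggedUnion (λ k xs → xs ++ [ k ]) (λ {_} {xs} {ys} eq → proj₁ (List.∷ʳ-injective xs ys eq)) (λ {_} {_} {xs} {ys} eq → proj₂ (List.∷ʳ-injective xs ys eq))

module Enumeration (c : ℕ) where
  open import Data.Nat using (_+_)
  open IntegerSums
  open Fibonacci
  open BlockPermutations using (weight)

  open ClosedFormℤ c using (b; f; ΣF)
  open Avoidance c using (InitBelow; Admissible)

  private
    +sum-applyUpTo : ∀ L (q g : ℕ → ℕ) → + sum (map g (applyUpTo q L)) ≡ Σ< L (λ k → + g (q k))
    +sum-applyUpTo zero q g = refl
    +sum-applyUpTo (suc L) q g = trans (ℤ.pos-+ (g (q 0)) _) (cong (ℤ._+_ (+ g (q 0))) (+sum-applyUpTo L (q ∘ suc) g))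

  -- The lists with entries below b and weight m, by recursion on a fuel argument fuel ≥ m;
  -- below-minus fuel m k lists those of weight m ∸ k when k ≤ m, and nothing otherwise.
  mutual
    below : ℕ → ℕ → List (List ℕ)
    below _ zero = [ [] ]
    below zero (suc m) = []
    below (suc fuel) (suc m) = Prepend.⋃ (upTo b) (below-minus fuel m)

    below-minus : ℕ → ℕ → ℕ → List (List ℕ)
    below-minus fuel m zero = below fuel m
    below-minus fuel zero (suc k) = []
    below-minus fuel (suc m) (suc k) = below-minus fuel m k

  mutual
    length-below : ∀ fuel m → m ≤ fuel → + length (below fuel m) ≡ f (+ suc m)
    length-below fuel zero _ = refl
    length-below (suc fuel) (suc m) (s≤s m≤fuel) = begin
      + length (Prepend.⋃ (upTo b) (below-minus fuel m))        ≡⟨ cong +_ (Prepend.length-⋃ (upTo b) (below-minus fuel m)) ⟩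
      + sum (map (length ∘ below-minus fuel m) (upTo b))          ≡⟨ +sum-applyUpTo b (λ k → k) (length ∘ below-minus fuel m) ⟩
      Σ< b (λ k → + length (below-minus fuel m k))                ≡⟨ Σ<-cong b (λ k → length-below-minus fuel m k m≤fuel) ⟩
      Σ< b (λ k → f (+ suc m ℤ.- + k))                              ≡⟨ sym (F-recurrence b m) ⟩
      f (+ suc (suc m)) ∎
      where open ≡-Reasoning

    length-below-minus : ∀ fuel m k → m ≤ fuel → + length (below-minus fuel m k) ≡ f (+ suc m ℤ.- + k)
    length-below-minus fuel m zero m≤fuel = trans (length-below fuel m m≤fuel) (cong f (sym (ℤ.+-identityʳ (+ suc m))))
    length-below-minus fuel zero (suc zero) _ = refl
    length-below-minus fuel zero (suc (suc k)) _ = refl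
    length-below-minus fuel (suc m) (suc k) m<fuel =
      trans (length-below-minus fuel m k (ℕ.≤-trans (ℕ.n≤1+n m) m<fuel)) (cong f (shift (+ m) (+ k)))
      where
      shift : ∀ x y → (+ 1 ℤ.+ x) ℤ.- y ≡ (+ 2 ℤ.+ x) ℤ.- (+ 1 ℤ.+ y)
      shift = solve-∀

  mutual
    ∈-below⁻ : ∀ fuel m {xs} → xs ∈ below fuel m → All (_< b) xs × weight xs ≡ m
    ∈-below⁻ fuel zero (here refl) = [] , refl
    ∈-below⁻ (suc fuel) (suc m) xs∈ with Prepend.∈-⋃⁻ (upTo b) (below-minus fuel m) xs∈
    ... | k , ys , k∈ , ys∈ , refl with ∈-below-minus⁻ fuel m k ys∈
    ...   | k≤m , ys<b , weight-ys = ∈.∈-upTo⁻ k∈ ∷ ys<b , cong suc (trans (cong (_+_ k) weight-ys) (ℕ.m+[n∸m]≡n k≤m))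

    ∈-below-minus⁻ : ∀ fuel m k {ys} → ys ∈ below-minus fuel m k → k ≤ m × All (_< b) ys × weight ys ≡ m ∸ k
    ∈-below-minus⁻ fuel m zero ys∈ with ∈-below⁻ fuel m ys∈
    ... | ys<b , weight-ys = z≤n , ys<b , weight-ys
    ∈-below-minus⁻ fuel (suc m) (suc k) ys∈ with ∈-below-minus⁻ fuel m k ys∈
    ... | k≤m , ys<b , weight-ys = s≤s k≤m , ys<b , weight-ys

  below-minus-+ : ∀ fuel k m → below-minus fuel (k + m) k ≡ below fuel m
  below-minus-+ fuel zero m = refl
  below-minus-+ fuel (suc k) m = below-minus-+ fuel k m

  ∈-below⁺ : ∀ fuel xs → weight xs ≤ fuel → All (_< b) xs → xs ∈ below fuel (weight xs)
  ∈-below⁺ fuel [] _ _ = here refl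
  ∈-below⁺ (suc fuel) (k ∷ ys) (s≤s weight≤fuel) (k<b ∷ ys<b) =
    Prepend.∈-⋃⁺ (upTo b) (below-minus fuel (k + weight ys)) (∈.∈-upTo⁺ k<b)
      (subst (ys ∈_) (sym (below-minus-+ fuel k (weight ys))) (∈-below⁺ fuel ys (ℕ.≤-trans (ℕ.m≤n+m (weight ys) k) weight≤fuel) ys<b))

  mutual
    below-unique : ∀ fuel m → Unique (below fuel m)
    below-unique fuel zero = [] ∷ []
    below-unique zero (suc m) = []
    below-unique (suc fuel) (suc m) = Prepend.⋃-unique (upTo b) (below-minus fuel m) (Unique.upTo⁺ b) (below-minus-unique fuel m)

    below-minus-unique : ∀ fuel m k → Unique (below-minus fuel m k)
    below-minus-unique fuel m zero = below-unique fuel m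
    below-minus-unique fuel zero (suc k) = []
    below-minus-unique fuel (suc m) (suc k) = below-minus-unique fuel m k

  partsBelow : ℕ → List (List ℕ)
  partsBelow m = below m m

  length-partsBelow : ∀ m → length (partsBelow m) ≡ Fℕ b (suc m)
  length-partsBelow m = ℤ.+-injective (length-below m m ℕ.≤-refl)

  ∈-partsBelow : ∀ m xs → xs ∈ partsBelow m ⇔ (All (_< b) xs × weight xs ≡ m)
  ∈-partsBelow m xs = mk⇔ (∈-below⁻ m m) (λ { (xs<b , refl) → ∈-below⁺ (weight xs) xs ℕ.≤-refl xs<b })

  weight-∷ʳ : ∀ hs ℓ → weight (hs ++ [ ℓ ]) ≡ suc (weight hs + ℓ)
  weight-∷ʳ [] ℓ = cong suc (ℕ.+-identityʳ ℓ)
  weight-∷ʳ (k ∷ hs) ℓ = trans (cong (_+_ (suc k)) (weight-∷ʳ hs ℓ)) (cong suc (trans (ℕ.+-suc k (weight hs + ℓ)) (cong suc (sym (ℕ.+-assoc k (weight hs) ℓ)))))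

  InitBelow-∷ʳ⁻ : ∀ hs ℓ → InitBelow (hs ++ [ ℓ ]) → All (_< b) hs
  InitBelow-∷ʳ⁻ [] ℓ _ = []
  InitBelow-∷ʳ⁻ (k ∷ []) ℓ (k<b , _) = k<b ∷ []
  InitBelow-∷ʳ⁻ (k ∷ k′ ∷ hs) ℓ (k<b , below) = k<b ∷ InitBelow-∷ʳ⁻ (k′ ∷ hs) ℓ below

  InitBelow-∷ʳ⁺ : ∀ hs ℓ → All (_< b) hs → InitBelow (hs ++ [ ℓ ])
  InitBelow-∷ʳ⁺ [] ℓ _ = tt
  InitBelow-∷ʳ⁺ (k ∷ []) ℓ (k<b ∷ _) = k<b , tt
  InitBelow-∷ʳ⁺ (k ∷ k′ ∷ hs) ℓ (k<b ∷ hs<b) = k<b , InitBelow-∷ʳ⁺ (k′ ∷ hs) ℓ hs<b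

  initBelow : ℕ → List (List ℕ)
  initBelow zero = [ [] ]
  initBelow (suc m) = Append.⋃ (upTo (suc m)) (λ ℓ → partsBelow (m ∸ ℓ))

  admissibles : ℕ → List (List ℕ)
  admissibles zero = [ [] ]
  admissibles (suc n) = Prepend.⋃ (upTo (suc n)) (λ k → initBelow (n ∸ k))

  ∈-initBelow⁻ : ∀ j {xs} → xs ∈ initBelow j → InitBelow xs × weight xs ≡ j
  ∈-initBelow⁻ zero (here refl) = tt , refl
  ∈-initBelow⁻ (suc m) xs∈ with Append.∈-⋃⁻ (upTo (suc m)) (λ ℓ → partsBelow (m ∸ ℓ)) xs∈
  ... | ℓ , hs , ℓ∈ , hs∈ , refl with Equivalence.to (∈-partsBelow (m ∸ ℓ) hs) hs∈
  ...   | hs<b , weight-hs = InitBelow-∷ʳ⁺ hs ℓ hs<b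
                           , trans (weight-∷ʳ hs ℓ) (cong suc (trans (cong (_+ ℓ) weight-hs) (ℕ.m∸n+n≡m (ℕ.≤-pred (∈.∈-upTo⁻ ℓ∈)))))

  ∈-initBelow⁺ : ∀ xs → InitBelow xs → xs ∈ initBelow (weight xs)
  ∈-initBelow⁺ xs below with initLast xs
  ... | [] = here refl
  ... | hs ∷ʳ′ ℓ = subst (λ w → (hs ++ [ ℓ ]) ∈ initBelow w) (sym (weight-∷ʳ hs ℓ))
    (Append.∈-⋃⁺ (upTo (suc (weight hs + ℓ))) (λ ℓ′ → partsBelow ((weight hs + ℓ) ∸ ℓ′)) (∈.∈-upTo⁺ (s≤s (ℕ.m≤n+m ℓ (weight hs))))
      (Equivalence.from (∈-partsBelow _ hs) (InitBelow-∷ʳ⁻ hs ℓ below , sym (ℕ.m+n∸n≡m (weight hs) ℓ))))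

  ∈-admissibles⁻ : ∀ n {xs} → xs ∈ admissibles n → Admissible xs × weight xs ≡ n
  ∈-admissibles⁻ zero (here refl) = tt , refl
  ∈-admissibles⁻ (suc n) xs∈ with Prepend.∈-⋃⁻ (upTo (suc n)) (λ k → initBelow (n ∸ k)) xs∈
  ... | k , ys , k∈ , ys∈ , refl with ∈-initBelow⁻ (n ∸ k) ys∈
  ...   | below , weight-ys = below , cong suc (trans (cong (_+_ k) weight-ys) (ℕ.m+[n∸m]≡n (ℕ.≤-pred (∈.∈-upTo⁻ k∈))))

  ∈-admissibles⁺ : ∀ xs → Admissible xs → xs ∈ admissibles (weight xs)
  ∈-admissibles⁺ [] _ = here refl
  ∈-admissibles⁺ (k ∷ ys) admissible =
    Prepend.∈-⋃⁺ (upTo (suc (k + weight ys))) (λ k′ → initBelow ((k + weight ys) ∸ k′)) (∈.∈-upTo⁺ (s≤s (ℕ.m≤m+n k (weight ys))))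
      (subst (λ w → ys ∈ initBelow w) (sym (ℕ.m+n∸m≡n k (weight ys))) (∈-initBelow⁺ ys admissible))

  initBelow-unique : ∀ j → Unique (initBelow j)
  initBelow-unique zero = [] ∷ []
  initBelow-unique (suc m) = Append.⋃-unique (upTo (suc m)) _ (Unique.upTo⁺ (suc m)) (λ ℓ → below-unique (m ∸ ℓ) (m ∸ ℓ))

  admissibles-unique : ∀ n → Unique (admissibles n)
  admissibles-unique zero = [] ∷ []
  admissibles-unique (suc n) = Prepend.⋃-unique (upTo (suc n)) _ (Unique.upTo⁺ (suc n)) (λ k → initBelow-unique (n ∸ k))

  private
    length-initBelow-Σ : ∀ m → + length (initBelow (suc m)) ≡ Σ< (suc m) (λ ℓ → + length (partsBelow (m ∸ ℓ)))
    length-initBelow-Σ m = trans (cong +_ (Append.length-⋃ (upTo (suc m)) (λ ℓ → partsBelow (m ∸ ℓ))))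
                                 (+sum-applyUpTo (suc m) (λ ℓ → ℓ) (λ ℓ → length (partsBelow (m ∸ ℓ))))

    length-admissibles-Σ : ∀ n → + length (admissibles (suc n)) ≡ Σ< (suc n) (λ k → + length (initBelow (n ∸ k)))
    length-admissibles-Σ n = trans (cong +_ (Prepend.length-⋃ (upTo (suc n)) (λ k → initBelow (n ∸ k))))
                                   (+sum-applyUpTo (suc n) (λ k → k) (λ k → length (initBelow (n ∸ k))))

  length-initBelow : ∀ m → + length (initBelow (suc m)) ≡ + ΣF (suc m)
  length-initBelow zero = refl
  length-initBelow (suc m) = begin
    + length (initBelow (2 + m))
      ≡⟨ length-initBelow-Σ (suc m) ⟩
    + length (partsBelow (suc m)) ℤ.+ Σ< (suc m) (λ ℓ → + length (partsBelow (m ∸ ℓ)))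
      ≡⟨ cong₂ ℤ._+_ (cong +_ (length-partsBelow (suc m))) (sym (length-initBelow-Σ m)) ⟩
    + Fℕ b (2 + m) ℤ.+ + length (initBelow (suc m))
      ≡⟨ cong (ℤ._+_ (+ Fℕ b (2 + m))) (length-initBelow m) ⟩
    + Fℕ b (2 + m) ℤ.+ + ΣF (suc m)
      ≡⟨ trans (ℤ.+-comm (+ Fℕ b (2 + m)) (+ ΣF (suc m))) (sym (ℤ.pos-+ (ΣF (suc m)) (Fℕ b (2 + m)))) ⟩
    + ΣF (2 + m) ∎
    where open ≡-Reasoning

  count : ℕ → ℕ
  count n = length (admissibles n)

  count-0 : count 0 ≡ 1
  count-0 = refl

  count-suc : ∀ n → count (suc n) ≡ count n + ΣF n
  count-suc zero = refl
  count-suc (suc n) = ℤ.+-injective (begin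
    + count (2 + n)
      ≡⟨ length-admissibles-Σ (suc n) ⟩
    + length (initBelow (suc n)) ℤ.+ Σ< (suc n) (λ k → + length (initBelow (n ∸ k)))
      ≡⟨ cong₂ ℤ._+_ (length-initBelow n) (sym (length-admissibles-Σ n)) ⟩
    + ΣF (suc n) ℤ.+ + count (suc n)
      ≡⟨ trans (ℤ.+-comm (+ ΣF (suc n)) (+ count (suc n))) (sym (ℤ.pos-+ (count (suc n)) (ΣF (suc n)))) ⟩
    + (count (suc n) + ΣF (suc n)) ∎)
    where open ≡-Reasoning

module Classification (c : ℕ) where
  open Patterns
  open BlockPermutations
  open Avoidance c
  open Characterisation c
  open Enumeration c

  admissible-blocks-avoid : ∀ ks → Admissible ks → All (Avoids (blocks ks)) (p132 ∷ p123 ∷ gamma b ∷ [])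
  admissible-blocks-avoid ks admissible = avoid-132 ∷ avoid-123 ∷ avoid-γ ∷ []
    where
    avoid-132 : Avoids (blocks ks) p132
    avoid-132 contains with Contains-132⁻ contains
    ... | x , y , z , p , x<z , z<y = NoTwoLargerAfter-blocks ks p (ℕ.<-trans x<z z<y) x<z
    avoid-123 : Avoids (blocks ks) p123
    avoid-123 contains with Contains-123⁻ contains
    ... | x , y , z , p , x<y , y<z = NoTwoLargerAfter-blocks ks p x<y (ℕ.<-trans x<y y<z)
    avoid-γ : Avoids (blocks ks) (gamma b)
    avoid-γ contains with Contains-γ⁻ b contains
    ... | A , d ∷ D , B , C , p , length≡b , B<A , D<B = γ-shape-impossible ks admissible A d D p B<A D<B (ℕ.≤-reflexive (sym length≡b))

  avoiders : ℕ → List (List ℕ)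
  avoiders n = map blocks (admissibles n)

  ∈-avoiders⁻ : ∀ n π → π ∈ avoiders n → InS n (p132 ∷ p123 ∷ gamma b ∷ []) π
  ∈-avoiders⁻ n π π∈ with ∈.∈-map⁻ blocks π∈
  ... | ks , ks∈ , refl with ∈-admissibles⁻ n ks∈
  ...   | admissible , refl = blocks-↭ ks , admissible-blocks-avoid ks admissible

  ∈-avoiders⁺ : ∀ n π → InS n (p132 ∷ p123 ∷ gamma b ∷ []) π → π ∈ avoiders n
  ∈-avoiders⁺ n π (π↭ , ¬132 ∷ ¬123 ∷ ¬γ ∷ []) with avoider-is-blocks n π π↭ ¬132 ¬123 ¬γ
  ... | ks , admissible , refl , refl = ∈.∈-map⁺ blocks (∈-admissibles⁺ ks admissible)

  avoiders-HasCard : ∀ n → HasCard (InS n (p132 ∷ p123 ∷ gamma b ∷ [])) (count n)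
  avoiders-HasCard n = avoiders n
                     , Unique.map⁺ (blocks-injective _ _) (admissibles-unique n)
                     , (λ π → mk⇔ (∈-avoiders⁻ n π) (∈-avoiders⁺ n π))
                     , List.length-map blocks (admissibles n)

open import Data.Nat using (_+_; _*_; >-nonZero)
open Combinatorics using (_C_)

mainTheorem10 : (b : ℕ) → (hb : 2 ≤ b) →
    Σ (ℕ → ℕ) λ a →
      -- a n = |S_n(132, 123, γ_{1,b,1})| for every n ≥ 0
      ((n : ℕ) → HasCard (InS n (p132 ∷ p123 ∷ gamma b ∷ [])) (a n))
      × ((n : ℕ) → 1 ≤ n →
          ℕ→ℚ (a n) ≡
            ((ℚ._/_ (+ 1) (b ∸ 1) {{ >-nonZero (m<n⇒0<n∸m hb) }}) ℚ.* (ℚ._/_ (+ 1) (b ∸ 1) {{ >-nonZero (m<n⇒0<n∸m hb) }}))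
            ℚ.* ( ((+ (b * b) ℤ.- + (3 * b)) ℚ./ 2)
                  ℚ.+ (ℤ→ℚ ((+ 1 ℤ.- + b) ℤ.* + n))
                  ℚ.+ ( (((+ (b * b) ℤ.- + b ℤ.+ + 2) ℚ./ 2) ℚ.* ℕ→ℚ (F b (+ (n + 1))))
                        ℚ.+ (ℤ→ℚ (+ b ℤ.- + 1) ℚ.* ℕ→ℚ (F b (+ n)))
                        ℚ.+ Σℚ (map (λ j → 2 + j) (upTo (b ∸ 2))) (λ i →
                              ( (ℤ→ℚ ((+ 1 ℤ.- + b) ℤ.* + (i C 2)))
                                ℚ.+ (((+ (b * b) ℤ.- + b ℤ.- + 2) ℚ./ 2) ℚ.* ℕ→ℚ i)
                                ℚ.- ((+ (b * b) ℤ.- + (3 * b)) ℚ./ 2) )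
                              ℚ.* ℕ→ℚ (F b (+ n ℤ.- + i ℤ.+ + 1))) ) ))
      × SeriesEq a (numPoly b) (denPoly b)
mainTheorem10 (suc (suc c)) (s≤s (s≤s z≤n)) =
    count
  , avoiders-HasCard
  , (λ n _ → ClosedFormℚ.a-closed-form c count count-0 count-suc n)
  , GeneratingFunction.seriesEq c count count-0 count-suc
  where
  open Classification c
  open Enumeration c using (count; count-0; count-suc)
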